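{- Let $r\ge 2$, $1\le d\le r$ and $1\le h\le d-1$ be integers with $(h+1)\mid dn$. Let $U_1\subseteq\mathbb{F}_{q^n}^d$ be an $\mathbb{F}_q$-subspace such that $L_{U_1}$ is a properly maximum $h$-scattered $\mathbb{F}_q$-linear set in $\mathrm{PG}(d-1,q^n)$, and let $$U=\{(x_0,\ldots,x_{r-1})\in\mathbb{F}_{q^n}^r:(x_0,\ldots,x_{d-1})\in U_1\}.$$ Then the $\mathbb{F}_q$-linear set $L_U$ in $\mathrm{PG}(r-1,q^n)$ has rank $\frac{dn}{h+1}+n(r-d)$, every point of $\mathrm{PG}(r-1,q^n)$ has weight $0$, $1$ or $n$ in $L_U$, and $$|L_U|=q^{n(r-d)}\left[\tfrac{dn}{h+1}\right]_q+[r-d]_{q^n}.$$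
   Context: For an $\mathbb{F}_q$-subspace $U$ of $\mathbb{F}_{q^n}^m$, the $\mathbb{F}_q$-linear set $L_U=\{\langle u\rangle_{\mathbb{F}_{q^n}}:u\in U\setminus\{0\}\}\subseteq\mathrm{PG}(m-1,q^n)$ has rank $\dim_{\mathbb{F}_q}U$; the weight of a projective subspace $\mathrm{PG}(W,\mathbb{F}_{q^n})$ (e.g. a point) in $L_U$ is $\dim_{\mathbb{F}_q}(U\cap W)$. $[k]_q=\frac{q^k-1}{q-1}$. An $\mathbb{F}_q$-linear set $L_{U_1}$ of $\mathrm{PG}(d-1,q^n)$ is $h$-scattered ($1\le h\le d-1$) if $L_{U_1}$ spans $\mathrm{PG}(d-1,q^n)$ and every $(h-1)$-dimensional projective subspace has weight at most $h$ in $L_{U_1}$; it is properly maximum $h$-scattered if moreover its rank equals $\frac{dn}{h+1}$. Geometrically, $L_U$ is the cone with vertex $S_2=\{x_0=\dots=x_{d-1}=0\}$ and base $L_{U_1}$ embedded in $S_1=\{x_d=\dots=x_{r-1}=0\}$ (when $d=r$, $S_2$ is empty). -}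

module Defs where

open import Level using (0ℓ)
open import Data.Nat using (ℕ; zero; suc; _+_; _*_; _∸_; _^_; _≤_; _<_)
open import Data.Nat.DivMod using (_/_)
open import Data.Fin using (Fin; toℕ; inject≤) renaming (zero to fz; suc to fs)
open import Data.Vec using (Vec; replicate; zipWith; map; lookup; tabulate)
open import Data.List using (List; length)
open import Data.List.Membership.Propositional using (_∈_)
open import Data.List.Relation.Unary.Unique.Propositional using (Unique)
open import Data.Product using (Σ; ∃; _×_; _,_)
open import Data.Sum using (_⊎_)
open import Relation.Binary.PropositionalEquality using (_≡_; _≢_)
open import Algebra.Core using (Op₁; Op₂)
open import Algebra.Structures using (IsCommutativeRing)

-- [k]_q = 1 + q + ... + q^(k-1)  ( = (q^k - 1)/(q - 1) for q ≥ 2 )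
[_]_ : ℕ → ℕ → ℕ
[ zero ] q = 0
[ suc k ] q = q ^ k + [ k ] q

-- A finite field F with q^n elements (F_{q^n}) together with a subfield K
-- with q elements (F_q), given as a duplicate-free list `sub`.
record FieldExt (q n : ℕ) : Set₁ where
  field
    F : Set
    _⊕_ _⊗_ : Op₂ F
    ⊖_ : Op₁ F
    0# 1# : F
    isCommutativeRing : IsCommutativeRing _≡_ _⊕_ _⊗_ ⊖_ 0# 1#
    0≢1 : 0# ≢ 1#
    inverse : ∀ x → x ≢ 0# → ∃ λ y → x ⊗ y ≡ 1#
    elems : List F
    elems-complete : ∀ x → x ∈ elems
    elems-unique : Unique elems
    elems-size : length elems ≡ q ^ n
    sub : List F
    sub-unique : Unique sub
    sub-size : length sub ≡ q
    sub-0 : 0# ∈ sub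
    sub-1 : 1# ∈ sub
    sub-+ : ∀ {x y} → x ∈ sub → y ∈ sub → (x ⊕ y) ∈ sub
    sub-* : ∀ {x y} → x ∈ sub → y ∈ sub → (x ⊗ y) ∈ sub
    sub-neg : ∀ {x} → x ∈ sub → (⊖ x) ∈ sub
    sub-inv : ∀ {x y} → x ∈ sub → x ⊗ y ≡ 1# → y ∈ sub

module Geometry {q n : ℕ} (E : FieldExt q n) where
  open FieldExt E

  0ᵥ : ∀ {m} → Vec F m
  0ᵥ = replicate _ 0#

  _+ᵥ_ : ∀ {m} → Vec F m → Vec F m → Vec F m
  _+ᵥ_ = zipWith _⊕_

  _·ᵥ_ : ∀ {m} → F → Vec F m → Vec F m
  a ·ᵥ v = map (a ⊗_) v

  lincomb : ∀ {m k} → (Fin k → F) → (Fin k → Vec F m) → Vec F m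
  lincomb {k = zero} c b = 0ᵥ
  lincomb {k = suc k} c b = (c fz ·ᵥ b fz) +ᵥ lincomb (λ i → c (fs i)) (λ i → b (fs i))

  inK : F → Set
  inK x = x ∈ sub

  VPred : ℕ → Set₁
  VPred m = Vec F m → Set

  _∩_ : ∀ {m} → VPred m → VPred m → VPred m
  (S ∩ T) x = S x × T x

  IsKSubspace : ∀ {m} → VPred m → Set
  IsKSubspace U = U 0ᵥ × (∀ u v → U u → U v → U (u +ᵥ v))
                       × (∀ a u → inK a → U u → U (a ·ᵥ u))

  KIndep : ∀ {m k} → (Fin k → Vec F m) → Set
  KIndep b = ∀ c → (∀ i → inK (c i)) → lincomb c b ≡ 0ᵥ → ∀ i → c i ≡ 0#

  FIndep : ∀ {m k} → (Fin k → Vec F m) → Set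
  FIndep b = ∀ c → lincomb c b ≡ 0ᵥ → ∀ i → c i ≡ 0#

  FSpan : ∀ {m k} → (Fin k → Vec F m) → VPred m
  FSpan b x = ∃ λ c → x ≡ lincomb c b

  HasDimK : ∀ {m} → VPred m → ℕ → Set
  HasDimK S k = Σ (Fin k → Vec _ _) λ b → (∀ i → S (b i)) × KIndep b
                × (∀ u → S u → ∃ λ c → (∀ i → inK (c i)) × u ≡ lincomb c b)

  PointWeight : ∀ {m} → VPred m → Vec F m → ℕ → Set
  PointWeight U v w = HasDimK (U ∩ FSpan (λ (_ : Fin 1) → v)) w

  SpansSpace : ∀ {m} → VPred m → Set
  SpansSpace {m} U = ∃ λ k → Σ (Fin k → Vec F m) λ b → (∀ i → U (b i)) × (∀ x → FSpan b x)

  -- h-scattered: spans, and every (h-1)-dim projective subspace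
  -- (= F_{q^n}-span of h independent vectors) has weight ≤ h
  IsHScattered : ∀ {m} → ℕ → VPred m → Set
  IsHScattered {m} h U = SpansSpace U
    × (∀ (w : Fin h → Vec F m) → FIndep w → ∀ k → HasDimK (U ∩ FSpan w) k → k ≤ h)

  IsProperlyMaxHScattered : ∀ {d} → ℕ → VPred d → Set
  IsProperlyMaxHScattered {d} h U = IsHScattered h U × HasDimK U ((d * n) / suc h)

  Cone : ∀ {d r} → d ≤ r → VPred d → VPred r
  Cone d≤r U1 x = U1 (tabulate (λ i → lookup x (inject≤ i d≤r)))

  InLinearSet : ∀ {m} → VPred m → Vec F m → Set
  InLinearSet U v = ∃ λ u → U u × u ≢ 0ᵥ × ∃ λ a → u ≡ a ·ᵥ v

  -- canonical representative of a projective point: first nonzero coordinate is 1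
  Normalized : ∀ {m} → Vec F m → Set
  Normalized {m} v = ∃ λ (i : Fin m) → lookup v i ≡ 1#
                     × (∀ (j : Fin m) → toℕ j < toℕ i → lookup v j ≡ 0#)

  -- |L_U| = N : the points of L_U are enumerated by a duplicate-free list of
  -- canonical representatives of length N
  LinearSetSize : ∀ {m} → VPred m → ℕ → Set
  LinearSetSize {m} U N = Σ (List (Vec F m)) λ P → Unique P
    × (∀ v → v ∈ P → Normalized v × InLinearSet U v)
    × (∀ v → Normalized v → InLinearSet U v → v ∈ P)
    × length P ≡ N

module Submission where

-- Write k = dn/(h+1) and e = r − d, so that U = U₁ × F_{q^n}^e. Counting gives |U| = q^k (q^n)^e,
-- hence rank k + ne. A point ⟨v⟩ in the vertex (first d coordinates zero) lies entirely in U and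
-- has weight n. For any other point, projecting onto the first d coordinates is injective on
-- U ∩ ⟨v⟩ and lands in U₁ ∩ ⟨v'⟩, where the weight is at most 1: since U₁ spans and h < d, two
-- F_q-independent multiples of v' in U₁, completed by h − 1 further vectors of U₁, give h + 1
-- F_q-independent vectors of U₁ in an (h−1)-dimensional projective subspace. Finally, counting the
-- nonzero vectors of U point by point, (q^n − 1)[e]_{q^n} + (q − 1)N = q^{k+ne} − 1, so there are
-- N = q^{ne}[k]_q points off the vertex.

open import Defs
open import Data.Nat using (ℕ; suc; _+_; _*_; _∸_; _^_; _≤_)
open import Data.Nat.DivMod using (_/_)
open import Data.Nat.Divisibility using (_∣_)
open import Data.Vec using (Vec)
open import Data.Product using (_×_)
open import Data.Sum using (_⊎_)
open import Relation.Binary.PropositionalEquality using (_≢_)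

open import Algebra.Bundles using (CommutativeRing)
import Algebra.Properties.CommutativeSemigroup as CommutativeSemigroupProperties
import Algebra.Properties.Group as GroupProperties
import Algebra.Properties.Ring as RingProperties
open import Algebra.Structures using (IsCommutativeRing)
open import Data.Fin using (Fin; inject≤) renaming (zero to fzero; suc to fsuc)
import Data.Fin.Properties as Fin
open import Data.List as List using (List; []; _∷_; length; filter; concatMap; cartesianProductWith)
open import Data.List.Membership.Propositional using (_∈_; find; lose)
open import Data.List.Membership.Propositional.Properties
  using ( ∈-length; ∈-map⁺; ∈-map⁻; ∈-++⁺ˡ; ∈-++⁺ʳ; ∈-++⁻; ∈-filter⁺; ∈-filter⁻; ∈-concatMap⁺; ∈-concatMap⁻
        ; ∈-cartesianProductWith⁺; ∈-cartesianProductWith⁻)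
import Data.List.Properties as List
open import Data.List.Relation.Binary.Subset.Propositional using (_⊆_)
open import Data.List.Relation.Unary.All as All using (All)
open import Data.List.Relation.Unary.All.Properties using (¬All⇒Any¬)
open import Data.List.Relation.Unary.AllPairs using ([]; _∷_)
open import Data.List.Relation.Unary.Any as Any using (here; there)
open import Data.List.Relation.Unary.Unique.Propositional using (Unique)
import Data.List.Relation.Unary.Unique.Propositional.Properties as Unique
open import Data.Nat using (zero; _<_; z≤n; s≤s; >-nonZero)
open import Data.Nat.Properties hiding (_≟_)
open import Data.Product using (Σ; ∃; ∃₂; _,_; proj₁; proj₂)
open import Data.Sum using (inj₁; inj₂; [_,_]′)
open import Data.Vec using ([]; _∷_; lookup; tabulate; replicate; map; zipWith; truncate; _++_; splitAt)
open import Data.Vec.Functional using () renaming (_∷_ to _∷ᶠ_)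
import Data.Vec.Properties as Vec
open import Function using (_∘_)
open import Level using (0ℓ)
open import Relation.Binary.Definitions using (DecidableEquality; tri<; tri≈; tri>)
open import Relation.Binary.PropositionalEquality
  using (_≡_; refl; sym; trans; cong; cong₂; subst; subst₂; module ≡-Reasoning)
open import Relation.Nullary using (Dec; yes; no; ¬_; ¬?; contradiction)
open import Relation.Nullary.Decidable using (map′; _×-dec_; _⊎-dec_)
open import Relation.Unary using (Decidable)
open import Relation.Unary.Properties using (∁?)

^-injectiveʳ : ∀ {m} → 1 < m → ∀ {x y} → m ^ x ≡ m ^ y → x ≡ y
^-injectiveʳ {m} 1<m {x} {y} eq with <-cmp x y
... | tri< x<y _ _ = contradiction eq (<⇒≢ (^-monoʳ-< m 1<m x<y))
... | tri≈ _ x≡y _ = x≡y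
... | tri> _ _ y<x = contradiction (sym eq) (<⇒≢ (^-monoʳ-< m 1<m y<x))

^-cancelʳ-≤ : ∀ {m} → 1 < m → ∀ {x y} → m ^ x ≤ m ^ y → x ≤ y
^-cancelʳ-≤ {m} 1<m {x} {y} le with ≤-<-connex x y
... | inj₁ x≤y = x≤y
... | inj₂ y<x = contradiction le (<⇒≱ (^-monoʳ-< m 1<m y<x))

n<m^n : ∀ {m} → 1 < m → ∀ n → n < m ^ n
n<m^n 1<m zero = s≤s z≤n
n<m^n {m} 1<m (suc n) = begin-strict
  suc n          ≡⟨ +-identityʳ (suc n) ⟨
  suc n + 0      <⟨ +-mono-≤-< (n<m^n 1<m n) (m^n>0 m {{>-nonZero (<-trans (s≤s z≤n) 1<m)}} n) ⟩
  m ^ n + m ^ n  ≡⟨ cong (m ^ n +_) (+-identityʳ (m ^ n)) ⟨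
  2 * m ^ n      ≤⟨ *-monoˡ-≤ (m ^ n) 1<m ⟩
  m * m ^ n      ∎
  where open ≤-Reasoning

[]-geometric : ∀ a m → suc (a * [ m ] (suc a)) ≡ suc a ^ m
[]-geometric a zero = cong suc (*-zeroʳ a)
[]-geometric a (suc m) = begin
  suc (a * (suc a ^ m + [ m ] (suc a)))          ≡⟨ cong suc (*-distribˡ-+ a (suc a ^ m) _) ⟩
  suc (a * suc a ^ m + a * [ m ] (suc a))        ≡⟨ +-suc (a * suc a ^ m) _ ⟨
  a * suc a ^ m + suc (a * [ m ] (suc a))        ≡⟨ cong (a * suc a ^ m +_) ([]-geometric a m) ⟩
  a * suc a ^ m + suc a ^ m                      ≡⟨ +-comm (a * suc a ^ m) (suc a ^ m) ⟩
  suc a ^ m + a * suc a ^ m                      ∎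
  where open ≡-Reasoning

-- Duplicate-free lists as finite sets

record Enumerates {A : Set} (P : A → Set) (xs : List A) : Set where
  field
    unique : Unique xs
    sound : ∀ {x} → x ∈ xs → P x
    complete : ∀ {x} → P x → x ∈ xs

module _ {A : Set} where

  Unique⇒≡-dec : ∀ {xs : List A} {x y} → Unique xs → x ∈ xs → y ∈ xs → Dec (x ≡ y)
  Unique⇒≡-dec u (here refl) (here refl) = yes refl
  Unique⇒≡-dec (x∉ ∷ _) (here refl) (there y∈) = no (All.lookup x∉ y∈)
  Unique⇒≡-dec (x∉ ∷ _) (there x∈) (here refl) = no (All.lookup x∉ x∈ ∘ sym)
  Unique⇒≡-dec (_ ∷ u) (there x∈) (there y∈) = Unique⇒≡-dec u x∈ y∈

  Unique-map⁺ : ∀ {B : Set} (f : A → B) {xs}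
    → (∀ {x y} → x ∈ xs → y ∈ xs → f x ≡ f y → x ≡ y) → Unique xs → Unique (List.map f xs)
  Unique-map⁺ f _ [] = []
  Unique-map⁺ f inj (x∉ ∷ u) = All.tabulate (λ {y} y∈ fx≡fy → let z , z∈ , y≡fz = ∈-map⁻ f y∈ in
      All.lookup x∉ z∈ (inj (here refl) (there z∈) (trans fx≡fy y≡fz)))
    ∷ Unique-map⁺ f (λ x∈ y∈ → inj (there x∈) (there y∈)) u

  Enumerates-filter : ∀ {P Q : A → Set} {xs} (Q? : Decidable Q)
    → Enumerates P xs → Enumerates (λ x → Q x × P x) (filter Q? xs)
  Enumerates-filter Q? e = record
    { unique = Unique.filter⁺ Q? unique
    ; sound = λ x∈ → let x∈xs , qx = ∈-filter⁻ Q? x∈ in qx , sound x∈xs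
    ; complete = λ (qx , px) → ∈-filter⁺ Q? (complete px) qx
    }
    where open Enumerates e

  length-filter+length-filter-∁ : ∀ {P : A → Set} (P? : Decidable P) xs
    → length (filter P? xs) + length (filter (∁? P?) xs) ≡ length xs
  length-filter+length-filter-∁ P? [] = refl
  length-filter+length-filter-∁ P? (x ∷ xs) with P? x
  ... | yes _ = cong suc (length-filter+length-filter-∁ P? xs)
  ... | no _ = trans (+-suc _ _) (cong suc (length-filter+length-filter-∁ P? xs))

  length-cartesianProductWith : ∀ {B C : Set} (f : A → B → C) xs ys
    → length (cartesianProductWith f xs ys) ≡ length xs * length ys
  length-cartesianProductWith f [] ys = refl
  length-cartesianProductWith f (x ∷ xs) ys = trans (List.length-++ (List.map (f x) ys))
    (cong₂ _+_ (List.length-map (f x) ys) (length-cartesianProductWith f xs ys))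

  vectors : List A → ∀ m → List (Vec A m)
  vectors xs zero = [] ∷ []
  vectors xs (suc m) = cartesianProductWith _∷_ xs (vectors xs m)

  length-vectors : ∀ xs m → length (vectors xs m) ≡ length xs ^ m
  length-vectors xs zero = refl
  length-vectors xs (suc m) =
    trans (length-cartesianProductWith _∷_ xs (vectors xs m)) (cong (length xs *_) (length-vectors xs m))

  Unique-vectors : ∀ {xs} → Unique xs → ∀ m → Unique (vectors xs m)
  Unique-vectors u zero = All.[] ∷ []
  Unique-vectors u (suc m) = Unique.cartesianProductWith⁺ _∷_ Vec.∷-injective u (Unique-vectors u m)

  ∈-vectors⁺ : ∀ {xs m} {v : Vec A m} → (∀ i → lookup v i ∈ xs) → v ∈ vectors xs m
  ∈-vectors⁺ {v = []} _ = here refl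
  ∈-vectors⁺ {v = x ∷ v} h = ∈-cartesianProductWith⁺ _∷_ (h fzero) (∈-vectors⁺ (h ∘ fsuc))

  ∈-vectors⁻ : ∀ {xs m} {v : Vec A m} → v ∈ vectors xs m → ∀ i → lookup v i ∈ xs
  ∈-vectors⁻ {xs} {suc m} v∈ i with ∈-cartesianProductWith⁻ _∷_ xs (vectors xs m) v∈
  ∈-vectors⁻ {xs} {suc m} v∈ fzero | _ , _ , x∈ , _ , refl = x∈
  ∈-vectors⁻ {xs} {suc m} v∈ (fsuc i) | _ , _ , _ , w∈ , refl = ∈-vectors⁻ w∈ i

module _ {A : Set} where

  truncate-zipWith : ∀ {m n} (f : A → A → A) (m≤n : m ≤ n) (xs ys : Vec A n)
    → truncate m≤n (zipWith f xs ys) ≡ zipWith f (truncate m≤n xs) (truncate m≤n ys)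
  truncate-zipWith f z≤n _ _ = refl
  truncate-zipWith f (s≤s m≤n) (x ∷ xs) (y ∷ ys) = cong (f x y ∷_) (truncate-zipWith f m≤n xs ys)

  truncate-map : ∀ {m n} (f : A → A) (m≤n : m ≤ n) (xs : Vec A n) → truncate m≤n (map f xs) ≡ map f (truncate m≤n xs)
  truncate-map f z≤n _ = refl
  truncate-map f (s≤s m≤n) (x ∷ xs) = cong (f x ∷_) (truncate-map f m≤n xs)

  truncate-replicate : ∀ {m n} (m≤n : m ≤ n) (x : A) → truncate m≤n (replicate n x) ≡ replicate m x
  truncate-replicate z≤n x = refl
  truncate-replicate (s≤s m≤n) x = cong (x ∷_) (truncate-replicate m≤n x)

  truncate-++ : ∀ {m n} (m≤m+n : m ≤ m + n) (u : Vec A m) (w : Vec A n) → truncate m≤m+n (u ++ w) ≡ u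
  truncate-++ _ [] w = refl
  truncate-++ (s≤s m≤m+n) (x ∷ u) w = cong (x ∷_) (truncate-++ m≤m+n u w)

  lookup-ext : ∀ {m} {u v : Vec A m} → (∀ i → lookup u i ≡ lookup v i) → u ≡ v
  lookup-ext {u = u} {v} u≗v = trans (sym (Vec.tabulate∘lookup u)) (trans (Vec.tabulate-cong u≗v) (Vec.tabulate∘lookup v))

  tabulate-lookup-inject≤ : ∀ {m n} (m≤n : m ≤ n) (xs : Vec A n)
    → tabulate (λ i → lookup xs (inject≤ i m≤n)) ≡ truncate m≤n xs
  tabulate-lookup-inject≤ m≤n xs =
    trans (Vec.tabulate-cong (sym ∘ Vec.lookup-truncate m≤n xs)) (Vec.tabulate∘lookup (truncate m≤n xs))

module _ {A : Set} (_≟_ : DecidableEquality A) where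

  _≢?_ : ∀ (x y : A) → Dec (x ≢ y)
  x ≢? y = ¬? (x ≟ y)

  remove : A → List A → List A
  remove x = filter (_≢? x)

  length-remove : ∀ {x xs} → Unique xs → x ∈ xs → suc (length (remove x xs)) ≡ length xs
  length-remove {x} (y∉ ∷ _) (here refl) = cong (suc ∘ length)
    (trans (List.filter-reject (_≢? x) (λ x≢x → x≢x refl)) (List.filter-all (_≢? x) (All.map (_∘ sym) y∉)))
  length-remove {x} (y∉ ∷ u) (there x∈) =
    trans (cong (suc ∘ length) (List.filter-accept (_≢? x) (All.lookup y∉ x∈))) (cong suc (length-remove u x∈))

  Unique-⊆⇒length≤ : ∀ {xs ys} → Unique xs → xs ⊆ ys → length xs ≤ length ys
  Unique-⊆⇒length≤ {[]} _ _ = z≤n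
  Unique-⊆⇒length≤ {x ∷ xs} {ys} (x∉ ∷ u) xs⊆ys = begin-strict
    length xs             ≤⟨ Unique-⊆⇒length≤ u (λ y∈ → ∈-filter⁺ (_≢? x) (xs⊆ys (there y∈)) (All.lookup x∉ y∈ ∘ sym)) ⟩
    length (remove x ys)  <⟨ List.filter-notAll (_≢? x) ys (Any.map (λ x≡y y≢x → y≢x (sym x≡y)) (xs⊆ys (here refl))) ⟩
    length ys             ∎
    where open ≤-Reasoning

  Enumerates⇒length≡ : ∀ {P : A → Set} {xs ys} → Enumerates P xs → Enumerates P ys → length xs ≡ length ys
  Enumerates⇒length≡ e e' = ≤-antisym
    (Unique-⊆⇒length≤ (unique e) (complete e' ∘ sound e)) (Unique-⊆⇒length≤ (unique e') (complete e ∘ sound e'))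
    where open Enumerates

module _ {A B : Set} (f : A → List B) where

  Unique-concatMap : ∀ {xs} → Unique xs → (∀ {x} → x ∈ xs → Unique (f x))
    → (∀ {x x' y} → x ∈ xs → x' ∈ xs → y ∈ f x → y ∈ f x' → x ≡ x') → Unique (concatMap f xs)
  Unique-concatMap {[]} _ _ _ = []
  Unique-concatMap {x ∷ xs} (x∉ ∷ u) fu disjoint = Unique.++⁺ (fu (here refl))
    (Unique-concatMap u (fu ∘ there) (λ x∈ x'∈ → disjoint (there x∈) (there x'∈)))
    (λ (y∈fx , y∈rest) → let x' , x'∈ , y∈fx' = find (∈-concatMap⁻ f y∈rest) in
      All.lookup x∉ x'∈ (disjoint (here refl) (there x'∈) y∈fx y∈fx'))

  length-concatMap-twoValued : ∀ {P : A → Set} (P? : Decidable P) {a c} xs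
    → (∀ {x} → x ∈ xs → P x → length (f x) ≡ c)
    → (∀ {x} → x ∈ xs → ¬ P x → length (f x) ≡ a)
    → length (concatMap f xs) ≡ c * length (filter P? xs) + a * length (filter (∁? P?) xs)
  length-concatMap-twoValued P? {a} {c} [] _ _ = sym (cong₂ _+_ (*-zeroʳ c) (*-zeroʳ a))
  length-concatMap-twoValued P? {a} {c} (x ∷ xs) hc ha with P? x
  ... | yes px = begin
      length (f x List.++ concatMap f xs)     ≡⟨ List.length-++ (f x) ⟩
      length (f x) + length (concatMap f xs)  ≡⟨ cong₂ _+_ (hc (here refl) px) ih ⟩
      c + (c * Y + a * N)                     ≡⟨ +-assoc c (c * Y) (a * N) ⟨
      (c + c * Y) + a * N                     ≡⟨ cong (_+ a * N) (*-suc c Y) ⟨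
      c * suc Y + a * N                       ∎
    where
      open ≡-Reasoning
      Y = length (filter P? xs)
      N = length (filter (∁? P?) xs)
      ih = length-concatMap-twoValued P? xs (hc ∘ there) (ha ∘ there)
  ... | no ¬px = begin
      length (f x List.++ concatMap f xs)     ≡⟨ List.length-++ (f x) ⟩
      length (f x) + length (concatMap f xs)  ≡⟨ cong₂ _+_ (ha (here refl) ¬px) ih ⟩
      a + (c * Y + a * N)                     ≡⟨ ℕ+.x∙yz≈y∙xz a (c * Y) (a * N) ⟩
      c * Y + (a + a * N)                     ≡⟨ cong (c * Y +_) (*-suc a N) ⟨
      c * Y + a * suc N                       ∎
    where
      open ≡-Reasoning
      Y = length (filter P? xs)
      N = length (filter (∁? P?) xs)
      ih = length-concatMap-twoValued P? xs (hc ∘ there) (ha ∘ there)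
      module ℕ+ = CommutativeSemigroupProperties +-commutativeSemigroup

-- Vectors and linear algebra over a finite field

module FiniteField {q n : ℕ} (E : FieldExt q n) where
  open FieldExt E
  open Geometry E

  ring : CommutativeRing 0ℓ 0ℓ
  ring = record
    { Carrier = F ; _≈_ = _≡_ ; _+_ = _⊕_ ; _*_ = _⊗_ ; -_ = ⊖_ ; 0# = 0# ; 1# = 1#
    ; isCommutativeRing = isCommutativeRing }

  module R = IsCommutativeRing isCommutativeRing
  private
    module +-Group = GroupProperties (CommutativeRing.+-group ring)
    module +-Semigroup = CommutativeSemigroupProperties (CommutativeRing.+-commutativeSemigroup ring)
    module Ring = RingProperties (CommutativeRing.ring ring)

  _≟_ : DecidableEquality F
  x ≟ y = Unique⇒≡-dec elems-unique (elems-complete x) (elems-complete y)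

  _≟ᵥ_ : ∀ {m} → DecidableEquality (Vec F m)
  _≟ᵥ_ = Vec.≡-dec _≟_

  ⟨_⟩ : ∀ {m} → Vec F m → Fin 1 → Vec F m
  ⟨ v ⟩ _ = v

  inv : ∀ {x} → x ≢ 0# → F
  inv {x} x≢0 = proj₁ (inverse x x≢0)

  inv-inverseʳ : ∀ {x} (x≢0 : x ≢ 0#) → x ⊗ inv x≢0 ≡ 1#
  inv-inverseʳ {x} x≢0 = proj₂ (inverse x x≢0)

  inv-inverseˡ : ∀ {x} (x≢0 : x ≢ 0#) → inv x≢0 ⊗ x ≡ 1#
  inv-inverseˡ x≢0 = trans (R.*-comm _ _) (inv-inverseʳ x≢0)

  x⊗y≡0⇒y≡0 : ∀ {x y} → x ≢ 0# → x ⊗ y ≡ 0# → y ≡ 0#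
  x⊗y≡0⇒y≡0 {x} {y} x≢0 xy≡0 = begin
    y                 ≡⟨ R.*-identityˡ y ⟨
    1# ⊗ y            ≡⟨ cong (_⊗ y) (inv-inverseˡ x≢0) ⟨
    (inv x≢0 ⊗ x) ⊗ y ≡⟨ R.*-assoc _ x y ⟩
    inv x≢0 ⊗ (x ⊗ y) ≡⟨ cong (inv x≢0 ⊗_) xy≡0 ⟩
    inv x≢0 ⊗ 0#      ≡⟨ R.zeroʳ _ ⟩
    0#                ∎
    where open ≡-Reasoning

  x⊕y≡0⇒x≡-1⊗y : ∀ {x y} → x ⊕ y ≡ 0# → x ≡ (⊖ 1#) ⊗ y
  x⊕y≡0⇒x≡-1⊗y {x} {y} eq = trans (+-Group.inverseˡ-unique x y eq) (sym (Ring.-1*x≈-x y))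

  x⊖y≡0⇒x≡y : ∀ {x y} → x ⊕ (⊖ y) ≡ 0# → x ≡ y
  x⊖y≡0⇒x≡y = +-Group.x∙y⁻¹≈ε⇒x≈y _ _

  +ᵥ-assoc : ∀ {m} (u v w : Vec F m) → (u +ᵥ v) +ᵥ w ≡ u +ᵥ (v +ᵥ w)
  +ᵥ-assoc = Vec.zipWith-assoc R.+-assoc

  +ᵥ-identityˡ : ∀ {m} (u : Vec F m) → 0ᵥ +ᵥ u ≡ u
  +ᵥ-identityˡ = Vec.zipWith-identityˡ R.+-identityˡ

  +ᵥ-identityʳ : ∀ {m} (u : Vec F m) → u +ᵥ 0ᵥ ≡ u
  +ᵥ-identityʳ = Vec.zipWith-identityʳ R.+-identityʳ

  +ᵥ-interchange : ∀ {m} (u v w x : Vec F m) → (u +ᵥ v) +ᵥ (w +ᵥ x) ≡ (u +ᵥ w) +ᵥ (v +ᵥ x)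
  +ᵥ-interchange [] [] [] [] = refl
  +ᵥ-interchange (a ∷ u) (b ∷ v) (c ∷ w) (d ∷ x) =
    cong₂ _∷_ (+-Semigroup.interchange a b c d) (+ᵥ-interchange u v w x)

  +ᵥ-leftSwap : ∀ {m} (u v w : Vec F m) → u +ᵥ (v +ᵥ w) ≡ v +ᵥ (u +ᵥ w)
  +ᵥ-leftSwap [] [] [] = refl
  +ᵥ-leftSwap (a ∷ u) (b ∷ v) (c ∷ w) = cong₂ _∷_ (+-Semigroup.x∙yz≈y∙xz a b c) (+ᵥ-leftSwap u v w)

  ·ᵥ-distribʳ : ∀ {m} a b (u : Vec F m) → (a ⊕ b) ·ᵥ u ≡ (a ·ᵥ u) +ᵥ (b ·ᵥ u)
  ·ᵥ-distribʳ a b [] = refl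
  ·ᵥ-distribʳ a b (x ∷ u) = cong₂ _∷_ (R.distribʳ x a b) (·ᵥ-distribʳ a b u)

  ·ᵥ-distribˡ : ∀ {m} a (u v : Vec F m) → a ·ᵥ (u +ᵥ v) ≡ (a ·ᵥ u) +ᵥ (a ·ᵥ v)
  ·ᵥ-distribˡ a [] [] = refl
  ·ᵥ-distribˡ a (x ∷ u) (y ∷ v) = cong₂ _∷_ (R.distribˡ a x y) (·ᵥ-distribˡ a u v)

  ·ᵥ-assoc : ∀ {m} a b (u : Vec F m) → a ·ᵥ (b ·ᵥ u) ≡ (a ⊗ b) ·ᵥ u
  ·ᵥ-assoc a b [] = refl
  ·ᵥ-assoc a b (x ∷ u) = cong₂ _∷_ (sym (R.*-assoc a b x)) (·ᵥ-assoc a b u)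

  ·ᵥ-identityˡ : ∀ {m} (u : Vec F m) → 1# ·ᵥ u ≡ u
  ·ᵥ-identityˡ [] = refl
  ·ᵥ-identityˡ (x ∷ u) = cong₂ _∷_ (R.*-identityˡ x) (·ᵥ-identityˡ u)

  ·ᵥ-zeroˡ : ∀ {m} (u : Vec F m) → 0# ·ᵥ u ≡ 0ᵥ
  ·ᵥ-zeroˡ [] = refl
  ·ᵥ-zeroˡ (x ∷ u) = cong₂ _∷_ (R.zeroˡ x) (·ᵥ-zeroˡ u)

  ·ᵥ-zeroʳ : ∀ {m} a → a ·ᵥ 0ᵥ {m} ≡ 0ᵥ
  ·ᵥ-zeroʳ {m} a = trans (Vec.map-replicate (a ⊗_) 0# m) (cong (replicate m) (R.zeroʳ a))

  ·ᵥ≡0ᵥ⇒≡0 : ∀ {m a} {v : Vec F m} → v ≢ 0ᵥ → a ·ᵥ v ≡ 0ᵥ → a ≡ 0#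
  ·ᵥ≡0ᵥ⇒≡0 {v = []} v≢0 _ = contradiction refl v≢0
  ·ᵥ≡0ᵥ⇒≡0 {a = a} {x ∷ v} v≢0 av≡0 with x ≟ 0#
  ... | yes refl = ·ᵥ≡0ᵥ⇒≡0 (v≢0 ∘ cong (0# ∷_)) (Vec.∷-injectiveʳ av≡0)
  ... | no x≢0 = x⊗y≡0⇒y≡0 x≢0 (trans (R.*-comm x a) (Vec.∷-injectiveˡ av≡0))

  +ᵥ≡0ᵥ⇒≡-1·ᵥ : ∀ {m} (u v : Vec F m) → u +ᵥ v ≡ 0ᵥ → u ≡ (⊖ 1#) ·ᵥ v
  +ᵥ≡0ᵥ⇒≡-1·ᵥ [] [] _ = refl
  +ᵥ≡0ᵥ⇒≡-1·ᵥ (x ∷ u) (y ∷ v) eq =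
    cong₂ _∷_ (x⊕y≡0⇒x≡-1⊗y (Vec.∷-injectiveˡ eq)) (+ᵥ≡0ᵥ⇒≡-1·ᵥ u v (Vec.∷-injectiveʳ eq))

  solve-·ᵥ+ᵥ≡0ᵥ : ∀ {m a} {x r : Vec F m} (a≢0 : a ≢ 0#) → (a ·ᵥ x) +ᵥ r ≡ 0ᵥ → x ≡ (inv a≢0 ⊗ (⊖ 1#)) ·ᵥ r
  solve-·ᵥ+ᵥ≡0ᵥ {a = a} {x} {r} a≢0 eq = begin
    x                          ≡⟨ ·ᵥ-identityˡ x ⟨
    1# ·ᵥ x                    ≡⟨ cong (_·ᵥ x) (inv-inverseˡ a≢0) ⟨
    (inv a≢0 ⊗ a) ·ᵥ x         ≡⟨ ·ᵥ-assoc (inv a≢0) a x ⟨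
    inv a≢0 ·ᵥ (a ·ᵥ x)        ≡⟨ cong (inv a≢0 ·ᵥ_) (+ᵥ≡0ᵥ⇒≡-1·ᵥ (a ·ᵥ x) r eq) ⟩
    inv a≢0 ·ᵥ ((⊖ 1#) ·ᵥ r)   ≡⟨ ·ᵥ-assoc (inv a≢0) (⊖ 1#) r ⟩
    (inv a≢0 ⊗ (⊖ 1#)) ·ᵥ r      ∎
    where open ≡-Reasoning

  lincomb-cong : ∀ {m k} {c c' : Fin k → F} (b : Fin k → Vec F m) → (∀ i → c i ≡ c' i) → lincomb c b ≡ lincomb c' b
  lincomb-cong {k = zero} b _ = refl
  lincomb-cong {k = suc k} b c≗c' = cong₂ _+ᵥ_ (cong (_·ᵥ b fzero) (c≗c' fzero)) (lincomb-cong (b ∘ fsuc) (c≗c' ∘ fsuc))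

  lincomb-zero : ∀ {m k} (b : Fin k → Vec F m) → lincomb (λ _ → 0#) b ≡ 0ᵥ
  lincomb-zero {k = zero} b = refl
  lincomb-zero {k = suc k} b =
    trans (cong₂ _+ᵥ_ (·ᵥ-zeroˡ (b fzero)) (lincomb-zero (b ∘ fsuc))) (+ᵥ-identityˡ 0ᵥ)

  lincomb-+ : ∀ {m k} (c c' : Fin k → F) (b : Fin k → Vec F m) → lincomb (λ i → c i ⊕ c' i) b ≡ lincomb c b +ᵥ lincomb c' b
  lincomb-+ {k = zero} c c' b = sym (+ᵥ-identityˡ 0ᵥ)
  lincomb-+ {k = suc k} c c' b = trans
    (cong₂ _+ᵥ_ (·ᵥ-distribʳ (c fzero) (c' fzero) (b fzero)) (lincomb-+ (c ∘ fsuc) (c' ∘ fsuc) (b ∘ fsuc)))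
    (+ᵥ-interchange _ _ _ _)

  lincomb-⊗ : ∀ {m k} a (c : Fin k → F) (b : Fin k → Vec F m) → lincomb (λ i → a ⊗ c i) b ≡ a ·ᵥ lincomb c b
  lincomb-⊗ {k = zero} a c b = sym (·ᵥ-zeroʳ a)
  lincomb-⊗ {k = suc k} a c b = trans
    (cong₂ _+ᵥ_ (sym (·ᵥ-assoc a (c fzero) (b fzero))) (lincomb-⊗ a (c ∘ fsuc) (b ∘ fsuc)))
    (sym (·ᵥ-distribˡ a _ _))

  lincomb-⊖ : ∀ {m k} {c c' : Fin k → F} (b : Fin k → Vec F m)
    → lincomb c b ≡ lincomb c' b → lincomb (λ i → c i ⊕ (⊖ c' i)) b ≡ 0ᵥ
  lincomb-⊖ {c = c} {c'} b eq = begin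
    lincomb (λ i → c i ⊕ (⊖ c' i)) b          ≡⟨ lincomb-+ c (⊖_ ∘ c') b ⟩
    lincomb c b +ᵥ lincomb (⊖_ ∘ c') b         ≡⟨ cong (_+ᵥ lincomb (⊖_ ∘ c') b) eq ⟩
    lincomb c' b +ᵥ lincomb (⊖_ ∘ c') b        ≡⟨ lincomb-+ c' (⊖_ ∘ c') b ⟨
    lincomb (λ i → c' i ⊕ (⊖ c' i)) b         ≡⟨ lincomb-cong b (R.-‿inverseʳ ∘ c') ⟩
    lincomb (λ _ → 0#) b                       ≡⟨ lincomb-zero b ⟩
    0ᵥ                                         ∎
    where open ≡-Reasoning

  ·ᵥ-cancelʳ : ∀ {m a b} {v : Vec F m} → v ≢ 0ᵥ → a ·ᵥ v ≡ b ·ᵥ v → a ≡ b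
  ·ᵥ-cancelʳ {a = a} {b} {v} v≢0 eq = x⊖y≡0⇒x≡y (·ᵥ≡0ᵥ⇒≡0 v≢0
    (trans (sym (+ᵥ-identityʳ _)) (lincomb-⊖ {c = λ _ → a} {λ _ → b} ⟨ v ⟩ (cong (_+ᵥ 0ᵥ) eq))))

  unit : ∀ {k} → Fin k → Fin k → F
  unit fzero fzero = 1#
  unit fzero (fsuc _) = 0#
  unit (fsuc i) fzero = 0#
  unit (fsuc i) (fsuc j) = unit i j

  lincomb-unit : ∀ {m k} (i : Fin k) (b : Fin k → Vec F m) → lincomb (unit i) b ≡ b i
  lincomb-unit fzero b = trans (cong₂ _+ᵥ_ (·ᵥ-identityˡ (b fzero)) (lincomb-zero (b ∘ fsuc))) (+ᵥ-identityʳ _)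
  lincomb-unit (fsuc i) b = trans (cong₂ _+ᵥ_ (·ᵥ-zeroˡ (b fzero)) (lincomb-unit i (b ∘ fsuc))) (+ᵥ-identityˡ _)

  allVectors : ∀ m → List (Vec F m)
  allVectors = vectors elems

  ∈-allVectors : ∀ {m} (v : Vec F m) → v ∈ allVectors m
  ∈-allVectors v = ∈-vectors⁺ (λ _ → elems-complete _)

  length-allVectors : ∀ m → length (allVectors m) ≡ (q ^ n) ^ m
  length-allVectors m = trans (length-vectors elems m) (cong (_^ m) elems-size)

  enumerate : ∀ {m} {S : VPred m} → Decidable S → List (Vec F m)
  enumerate {m} S? = filter S? (allVectors m)

  enumerate-Enumerates : ∀ {m} {S : VPred m} (S? : Decidable S) → Enumerates S (enumerate S?)
  enumerate-Enumerates {m} S? = record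
    { unique = Unique.filter⁺ S? (Unique-vectors elems-unique m)
    ; sound = λ v∈ → proj₂ (∈-filter⁻ S? {xs = allVectors m} v∈)
    ; complete = ∈-filter⁺ S? (∈-allVectors _)
    }

  FSpan-0 : ∀ {m k} (W : Fin k → Vec F m) → FSpan W 0ᵥ
  FSpan-0 W = (λ _ → 0#) , sym (lincomb-zero W)

  FSpan-+ : ∀ {m k} {W : Fin k → Vec F m} {u v} → FSpan W u → FSpan W v → FSpan W (u +ᵥ v)
  FSpan-+ {W = W} (c , refl) (c' , refl) = (λ i → c i ⊕ c' i) , sym (lincomb-+ c c' W)

  FSpan-· : ∀ {m k} {W : Fin k → Vec F m} {u} a → FSpan W u → FSpan W (a ·ᵥ u)
  FSpan-· {W = W} a (c , refl) = (λ i → a ⊗ c i) , sym (lincomb-⊗ a c W)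

  FSpan-generator : ∀ {m k} (W : Fin k → Vec F m) i → FSpan W (W i)
  FSpan-generator W i = unit i , sym (lincomb-unit i W)

  FSpan-single⁻ : ∀ {m} {v : Vec F m} {u} → FSpan ⟨ v ⟩ u → ∃ λ a → u ≡ a ·ᵥ v
  FSpan-single⁻ (c , refl) = c fzero , +ᵥ-identityʳ _

  FSpan-single⁺ : ∀ {m} {v : Vec F m} a → FSpan ⟨ v ⟩ (a ·ᵥ v)
  FSpan-single⁺ {v = v} a = FSpan-· {W = ⟨ v ⟩} a (FSpan-generator ⟨ v ⟩ fzero)

  record Subfield : Set where
    field
      elements : List F
      unique : Unique elements
      0∈ : 0# ∈ elements
      1∈ : 1# ∈ elements
      ⊕-closed : ∀ {x y} → x ∈ elements → y ∈ elements → (x ⊕ y) ∈ elements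
      ⊗-closed : ∀ {x y} → x ∈ elements → y ∈ elements → (x ⊗ y) ∈ elements
      ⊖-closed : ∀ {x} → x ∈ elements → (⊖ x) ∈ elements
      inv-closed : ∀ {x y} → x ∈ elements → x ⊗ y ≡ 1# → y ∈ elements

  𝔽q : Subfield
  𝔽q = record
    { elements = sub ; unique = sub-unique ; 0∈ = sub-0 ; 1∈ = sub-1
    ; ⊕-closed = sub-+ ; ⊗-closed = sub-* ; ⊖-closed = sub-neg ; inv-closed = sub-inv }

  𝔽qⁿ : Subfield
  𝔽qⁿ = record
    { elements = elems ; unique = elems-unique ; 0∈ = elems-complete _ ; 1∈ = elems-complete _
    ; ⊕-closed = λ _ _ → elems-complete _ ; ⊗-closed = λ _ _ → elems-complete _
    ; ⊖-closed = λ _ → elems-complete _ ; inv-closed = λ _ _ → elems-complete _ }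

  module LinearAlgebra (K : Subfield) where
    open Subfield K

    Independent : ∀ {m k} → (Fin k → Vec F m) → Set
    Independent b = ∀ c → (∀ i → c i ∈ elements) → lincomb c b ≡ 0ᵥ → ∀ i → c i ≡ 0#

    InSpan : ∀ {m k} → (Fin k → Vec F m) → VPred m
    InSpan b u = ∃ λ c → (∀ i → c i ∈ elements) × u ≡ lincomb c b

    IsSubspace : ∀ {m} → VPred m → Set
    IsSubspace U = U 0ᵥ × (∀ u v → U u → U v → U (u +ᵥ v)) × (∀ a u → a ∈ elements → U u → U (a ·ᵥ u))

    HasDim : ∀ {m} → VPred m → ℕ → Set
    HasDim S k = Σ (Fin k → Vec F _) λ b → (∀ i → S (b i)) × Independent b × (∀ u → S u → InSpan b u)

    InSpan⇒∈ : ∀ {m k} {S : VPred m} {b : Fin k → Vec F m} → IsSubspace S → (∀ i → S (b i)) → ∀ {u} → InSpan b u → S u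
    InSpan⇒∈ {k = zero} (S0 , _) _ (c , _ , refl) = S0
    InSpan⇒∈ {k = suc k} S-sub@(_ , S+ , S·) b∈S (c , c∈ , refl) = S+ _ _
      (S· (c fzero) _ (c∈ fzero) (b∈S fzero)) (InSpan⇒∈ S-sub (b∈S ∘ fsuc) (c ∘ fsuc , c∈ ∘ fsuc , refl))

    lincomb-injective : ∀ {m k} {b : Fin k → Vec F m} {c c'} → Independent b
      → (∀ i → c i ∈ elements) → (∀ i → c' i ∈ elements) → lincomb c b ≡ lincomb c' b → ∀ i → c i ≡ c' i
    lincomb-injective {b = b} ind c∈ c'∈ eq i =
      x⊖y≡0⇒x≡y (ind _ (λ j → ⊕-closed (c∈ j) (⊖-closed (c'∈ j))) (lincomb-⊖ b eq) i)

    span : ∀ {m k} → (Fin k → Vec F m) → List (Vec F m)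
    span {k = k} b = List.map (λ c → lincomb (lookup c) b) (vectors elements k)

    length-span : ∀ {m k} (b : Fin k → Vec F m) → length (span b) ≡ length elements ^ k
    length-span {k = k} b = trans (List.length-map _ (vectors elements k)) (length-vectors elements k)

    ∈-span⁺ : ∀ {m k} {b : Fin k → Vec F m} {u} → InSpan b u → u ∈ span b
    ∈-span⁺ {b = b} (c , c∈ , refl) = subst (_∈ span b) (lincomb-cong b (Vec.lookup∘tabulate c))
      (∈-map⁺ (λ c → lincomb (lookup c) b)
        (∈-vectors⁺ {v = tabulate c} (λ i → subst (_∈ elements) (sym (Vec.lookup∘tabulate c i)) (c∈ i))))

    ∈-span⁻ : ∀ {m k} {b : Fin k → Vec F m} {u} → u ∈ span b → InSpan b u
    ∈-span⁻ u∈ = let c , c∈ , u≡ = ∈-map⁻ _ u∈ in lookup c , ∈-vectors⁻ c∈ , u≡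

    Unique-span : ∀ {m k} {b : Fin k → Vec F m} → Independent b → Unique (span b)
    Unique-span {k = k} ind = Unique-map⁺ _
      (λ c∈ c'∈ eq → lookup-ext (lincomb-injective ind (∈-vectors⁻ c∈) (∈-vectors⁻ c'∈) eq)) (Unique-vectors unique k)

    InSpan? : ∀ {m k} (b : Fin k → Vec F m) → Decidable (InSpan b)
    InSpan? b u = map′ ∈-span⁻ ∈-span⁺ (Any.any? (u ≟ᵥ_) (span b))

    Independent₂ : F → F → Set
    Independent₂ a₀ a₁ =
      ∀ c₀ c₁ → c₀ ∈ elements → c₁ ∈ elements → (c₀ ⊗ a₀) ⊕ (c₁ ⊗ a₁) ≡ 0# → c₀ ≡ 0# × c₁ ≡ 0#

    multiples-independent : ∀ {m k a₀ a₁} {v : Vec F m} {b : Fin (suc (suc k)) → Vec F m} → Independent b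
      → b fzero ≡ a₀ ·ᵥ v → b (fsuc fzero) ≡ a₁ ·ᵥ v → Independent₂ a₀ a₁
    multiples-independent {a₀ = a₀} {a₁} {v} {b} ind b₀≡ b₁≡ c₀ c₁ c₀∈ c₁∈ c₀a₀+c₁a₁≡0 =
      c≡0 fzero , c≡0 (fsuc fzero)
      where
        open ≡-Reasoning
        c = c₀ ∷ᶠ c₁ ∷ᶠ (λ _ → 0#)
        c∈ : ∀ i → c i ∈ elements
        c∈ fzero = c₀∈
        c∈ (fsuc fzero) = c₁∈
        c∈ (fsuc (fsuc _)) = 0∈
        rest = lincomb (λ _ → 0#) (b ∘ fsuc ∘ fsuc)
        c≡0 = ind c c∈ (begin
          (c₀ ·ᵥ b fzero) +ᵥ ((c₁ ·ᵥ b (fsuc fzero)) +ᵥ rest)  ≡⟨ cong₂ (λ x y → (c₀ ·ᵥ x) +ᵥ ((c₁ ·ᵥ y) +ᵥ rest)) b₀≡ b₁≡ ⟩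
          (c₀ ·ᵥ (a₀ ·ᵥ v)) +ᵥ ((c₁ ·ᵥ (a₁ ·ᵥ v)) +ᵥ rest)    ≡⟨ cong (λ r → (c₀ ·ᵥ (a₀ ·ᵥ v)) +ᵥ r) (trans
                                                                   (cong ((c₁ ·ᵥ (a₁ ·ᵥ v)) +ᵥ_) (lincomb-zero (b ∘ fsuc ∘ fsuc)))
                                                                   (+ᵥ-identityʳ _)) ⟩
          (c₀ ·ᵥ (a₀ ·ᵥ v)) +ᵥ (c₁ ·ᵥ (a₁ ·ᵥ v))              ≡⟨ cong₂ _+ᵥ_ (·ᵥ-assoc c₀ a₀ v) (·ᵥ-assoc c₁ a₁ v) ⟩
          ((c₀ ⊗ a₀) ·ᵥ v) +ᵥ ((c₁ ⊗ a₁) ·ᵥ v)                ≡⟨ ·ᵥ-distribʳ _ _ v ⟨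
          ((c₀ ⊗ a₀) ⊕ (c₁ ⊗ a₁)) ·ᵥ v                        ≡⟨ cong (_·ᵥ v) c₀a₀+c₁a₁≡0 ⟩
          0# ·ᵥ v                                              ≡⟨ ·ᵥ-zeroˡ v ⟩
          0ᵥ                                                   ∎)

    FSpan-subspace : ∀ {m k} (W : Fin k → Vec F m) → IsSubspace (FSpan W)
    FSpan-subspace W = FSpan-0 W , (λ _ _ → FSpan-+) , (λ a _ _ → FSpan-· a)

    ∩-subspace : ∀ {m} {S T : VPred m} → IsSubspace S → IsSubspace T → IsSubspace (S ∩ T)
    ∩-subspace (S0 , S+ , S·) (T0 , T+ , T·) = (S0 , T0)
      , (λ u v (u∈S , u∈T) (v∈S , v∈T) → S+ u v u∈S v∈S , T+ u v u∈T v∈T)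
      , (λ a u a∈ (u∈S , u∈T) → S· a u a∈ u∈S , T· a u a∈ u∈T)

    HasDim⇒Decidable : ∀ {m k} {S : VPred m} → IsSubspace S → HasDim S k → Decidable S
    HasDim⇒Decidable S-sub (b , b∈S , _ , spans) u = map′ (InSpan⇒∈ S-sub b∈S) (spans u) (InSpan? b u)

    2≤|K| : 2 ≤ length elements
    2≤|K| = Unique-⊆⇒length≤ _≟_ ((0≢1 All.∷ All.[]) ∷ All.[] ∷ [])
      (λ { (here refl) → 0∈ ; (there (here refl)) → 1∈ })

    Independent⇒^≤length : ∀ {m k} {S : VPred m} {b : Fin k → Vec F m} {xs} → IsSubspace S
      → (∀ i → S (b i)) → Independent b → (∀ {u} → S u → u ∈ xs) → length elements ^ k ≤ length xs
    Independent⇒^≤length {b = b} S-sub b∈S ind S⊆xs = subst (_≤ _) (length-span b)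
      (Unique-⊆⇒length≤ _≟ᵥ_ (Unique-span ind) (S⊆xs ∘ InSpan⇒∈ S-sub b∈S ∘ ∈-span⁻))

    HasDim⇒length≡ : ∀ {m k} {S : VPred m} {xs} → IsSubspace S → HasDim S k → Enumerates S xs
      → length xs ≡ length elements ^ k
    HasDim⇒length≡ S-sub (b , b∈S , ind , spans) e = trans (Enumerates⇒length≡ _≟ᵥ_ e span-enumerates) (length-span b)
      where
        span-enumerates = record
          { unique = Unique-span ind ; sound = InSpan⇒∈ S-sub b∈S ∘ ∈-span⁻ ; complete = λ {u} → ∈-span⁺ ∘ spans u }

    Independent-∷ : ∀ {m k} {x : Vec F m} {b : Fin k → Vec F m} → Independent b → ¬ InSpan b x → Independent (x ∷ᶠ b)
    Independent-∷ {x = x} {b} ind x∉ c c∈ eq with c fzero ≟ 0#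
    ... | yes c₀≡0 = λ { fzero → c₀≡0 ; (fsuc i) → ind (c ∘ fsuc) (c∈ ∘ fsuc) rest≡0 i }
      where
        open ≡-Reasoning
        r = lincomb (c ∘ fsuc) b
        rest≡0 : r ≡ 0ᵥ
        rest≡0 = begin
          r                     ≡⟨ +ᵥ-identityˡ r ⟨
          0ᵥ +ᵥ r               ≡⟨ cong (_+ᵥ r) (trans (sym (·ᵥ-zeroˡ x)) (cong (_·ᵥ x) (sym c₀≡0))) ⟩
          (c fzero ·ᵥ x) +ᵥ r   ≡⟨ eq ⟩
          0ᵥ                    ∎
    ... | no c₀≢0 = contradiction (x-coefficients , x-coefficients∈ , x≡) x∉
      where
        a = inv c₀≢0 ⊗ (⊖ 1#)
        x-coefficients = λ i → a ⊗ c (fsuc i)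
        x-coefficients∈ = λ i → ⊗-closed (⊗-closed (inv-closed (c∈ fzero) (inv-inverseʳ c₀≢0)) (⊖-closed 1∈)) (c∈ (fsuc i))
        x≡ : x ≡ lincomb x-coefficients b
        x≡ = trans (solve-·ᵥ+ᵥ≡0ᵥ c₀≢0 eq) (sym (lincomb-⊗ a (c ∘ fsuc) b))

    Independent-swap : ∀ {m k} {x y : Vec F m} {b : Fin k → Vec F m}
      → Independent (x ∷ᶠ y ∷ᶠ b) → Independent (y ∷ᶠ x ∷ᶠ b)
    Independent-swap ind c c∈ eq = λ
      { fzero → c'≡0 (fsuc fzero) ; (fsuc fzero) → c'≡0 fzero ; (fsuc (fsuc i)) → c'≡0 (fsuc (fsuc i)) }
      where
        c' = c (fsuc fzero) ∷ᶠ c fzero ∷ᶠ (c ∘ fsuc ∘ fsuc)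
        c'∈ : ∀ i → c' i ∈ elements
        c'∈ fzero = c∈ (fsuc fzero)
        c'∈ (fsuc fzero) = c∈ fzero
        c'∈ (fsuc (fsuc i)) = c∈ (fsuc (fsuc i))
        c'≡0 = ind c' c'∈ (trans (+ᵥ-leftSwap _ _ _) eq)

    hasDim : ∀ {m} {S : VPred m} → Decidable S → IsSubspace S → ∃ (HasDim S)
    hasDim {m} {S} S? S-sub = grow (length members) (λ ()) (λ ()) (λ _ _ _ ()) ≤-refl
      where
        members = enumerate S?
        open Enumerates (enumerate-Enumerates S?)
        -- an independent family of size j in S forces j < |K|^j ≤ |S|, so |S| extension steps suffice
        grow : ∀ fuel {j} (b : Fin j → Vec F m) → (∀ i → S (b i)) → Independent b → length members ≤ j + fuel
          → ∃ (HasDim S)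
        extend : ∀ fuel {j} (b : Fin (suc j) → Vec F m) → (∀ i → S (b i)) → Independent b → length members ≤ j + fuel
          → ∃ (HasDim S)
        grow fuel {j} b b∈S ind bound with All.all? (InSpan? b) members
        ... | yes spanned = j , b , b∈S , ind , λ u u∈S → All.lookup spanned (complete u∈S)
        ... | no ¬spanned = let x , x∈ , x∉span = find (¬All⇒Any¬ (InSpan? b) members ¬spanned) in
          extend fuel (x ∷ᶠ b) (λ { fzero → sound x∈ ; (fsuc i) → b∈S i }) (Independent-∷ ind x∉span) bound
        extend zero {j} b b∈S ind bound = contradiction (Independent⇒^≤length S-sub b∈S ind complete) (<⇒≱ (begin-strict
          length members           ≤⟨ bound ⟩
          j + 0                    ≡⟨ +-identityʳ j ⟩
          j                        <⟨ n<1+n j ⟩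
          suc j                    <⟨ n<m^n 2≤|K| (suc j) ⟩
          length elements ^ suc j  ∎))
          where open ≤-Reasoning
        extend (suc fuel) {j} b b∈S ind bound = grow fuel b b∈S ind (subst (length members ≤_) (+-suc j fuel) bound)

    Independent⇒≤dim : ∀ {m j k} {S : VPred m} {b : Fin j → Vec F m} → Decidable S → IsSubspace S → HasDim S k
      → (∀ i → S (b i)) → Independent b → j ≤ k
    Independent⇒≤dim S? S-sub hd b∈S ind = ^-cancelʳ-≤ 2≤|K| (subst (_ ≤_) (HasDim⇒length≡ S-sub hd e)
      (Independent⇒^≤length S-sub b∈S ind (Enumerates.complete e)))
      where e = enumerate-Enumerates S?

    length≡⇒HasDim : ∀ {m k} {S : VPred m} {xs} → Decidable S → IsSubspace S → Enumerates S xs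
      → length xs ≡ length elements ^ k → HasDim S k
    length≡⇒HasDim {S = S} S? S-sub e len with hasDim S? S-sub
    ... | k , hd = subst (HasDim S) (^-injectiveʳ 2≤|K| (trans (sym (HasDim⇒length≡ S-sub hd e)) len)) hd

  module Fq = LinearAlgebra 𝔽q
  module Fqⁿ = LinearAlgebra 𝔽qⁿ

  1<q : 1 < q
  1<q = subst (2 ≤_) sub-size Fq.2≤|K|

  1<qⁿ : 1 < q ^ n
  1<qⁿ = subst (2 ≤_) elems-size Fqⁿ.2≤|K|

  HasDimK⇒length≡ : ∀ {m k} {S : VPred m} {xs} → IsKSubspace S → HasDimK S k → Enumerates S xs → length xs ≡ q ^ k
  HasDimK⇒length≡ {k = k} S-sub hd e = trans (Fq.HasDim⇒length≡ S-sub hd e) (cong (_^ k) sub-size)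

  length≡⇒HasDimK : ∀ {m k} {S : VPred m} {xs} → Decidable S → IsKSubspace S → Enumerates S xs → length xs ≡ q ^ k
    → HasDimK S k
  length≡⇒HasDimK {k = k} S? S-sub e len = Fq.length≡⇒HasDim S? S-sub e (trans len (cong (_^ k) (sym sub-size)))

  FSpan⇒InSpan : ∀ {m k} {W : Fin k → Vec F m} {u} → FSpan W u → Fqⁿ.InSpan W u
  FSpan⇒InSpan (c , u≡) = c , (λ _ → elems-complete _) , u≡

  FSpan? : ∀ {m k} (W : Fin k → Vec F m) → Decidable (FSpan W)
  FSpan? W u = map′ (λ (c , _ , u≡) → c , u≡) FSpan⇒InSpan (Fqⁿ.InSpan? W u)

  multiples : ∀ {m} → Vec F m → List (Vec F m)
  multiples v = List.map (_·ᵥ v) elems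

  multiples-Enumerates : ∀ {m} {v : Vec F m} → v ≢ 0ᵥ → Enumerates (FSpan ⟨ v ⟩) (multiples v)
  multiples-Enumerates {v = v} v≢0 = record
    { unique = Unique.map⁺ (·ᵥ-cancelʳ v≢0) elems-unique
    ; sound = λ u∈ → let a , _ , u≡ = ∈-map⁻ (_·ᵥ v) u∈ in subst (FSpan ⟨ v ⟩) (sym u≡) (FSpan-single⁺ a)
    ; complete = λ u∈ → let a , u≡ = FSpan-single⁻ u∈ in subst (_∈ multiples v) (sym u≡) (∈-map⁺ (_·ᵥ v) (elems-complete a))
    }

  InLinearSet? : ∀ {m} {U : VPred m} → Decidable U → Decidable (InLinearSet U)
  InLinearSet? {U = U} U? v = map′
    (λ any → let a , _ , av∈U , av≢0 = find {P = λ a → U (a ·ᵥ v) × a ·ᵥ v ≢ 0ᵥ} any in a ·ᵥ v , av∈U , av≢0 , a , refl)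
    (λ (u , u∈U , u≢0 , a , u≡) → lose (elems-complete a) (subst U u≡ u∈U , subst (_≢ 0ᵥ) u≡ u≢0))
    (Any.any? (λ a → U? (a ·ᵥ v) ×-dec ¬? ((a ·ᵥ v) ≟ᵥ 0ᵥ)) elems)

  Normalized-∷⁺ : ∀ {m x} {v : Vec F m} → x ≡ 1# ⊎ (x ≡ 0# × Normalized v) → Normalized (x ∷ v)
  Normalized-∷⁺ (inj₁ x≡1) = fzero , x≡1 , λ _ ()
  Normalized-∷⁺ (inj₂ (x≡0 , i , vᵢ≡1 , before)) = fsuc i , vᵢ≡1 , λ { fzero _ → x≡0 ; (fsuc j) (s≤s j<i) → before j j<i }

  Normalized-∷⁻ : ∀ {m x} {v : Vec F m} → Normalized (x ∷ v) → x ≡ 1# ⊎ (x ≡ 0# × Normalized v)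
  Normalized-∷⁻ (fzero , x≡1 , _) = inj₁ x≡1
  Normalized-∷⁻ (fsuc i , vᵢ≡1 , before) = inj₂ (before fzero (s≤s z≤n) , i , vᵢ≡1 , λ j j<i → before (fsuc j) (s≤s j<i))

  Normalized? : ∀ {m} → Decidable (Normalized {m})
  Normalized? [] = no λ ()
  Normalized? (x ∷ v) = map′ Normalized-∷⁺ Normalized-∷⁻ ((x ≟ 1#) ⊎-dec ((x ≟ 0#) ×-dec Normalized? v))

  Normalized⇒≢0ᵥ : ∀ {m} {v : Vec F m} → Normalized v → v ≢ 0ᵥ
  Normalized⇒≢0ᵥ (i , vᵢ≡1 , _) refl = 0≢1 (trans (sym (Vec.lookup-replicate i 0#)) vᵢ≡1)

  Normalized-0ᵥ++⁺ : ∀ {m k} {w : Vec F k} → Normalized w → Normalized (0ᵥ {m} ++ w)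
  Normalized-0ᵥ++⁺ {zero} nw = nw
  Normalized-0ᵥ++⁺ {suc m} nw = Normalized-∷⁺ (inj₂ (refl , Normalized-0ᵥ++⁺ nw))

  Normalized-0ᵥ++⁻ : ∀ {m k} {w : Vec F k} → Normalized (0ᵥ {m} ++ w) → Normalized w
  Normalized-0ᵥ++⁻ {zero} nw = nw
  Normalized-0ᵥ++⁻ {suc m} nw with Normalized-∷⁻ nw
  ... | inj₁ 0≡1 = contradiction 0≡1 0≢1
  ... | inj₂ (_ , nw') = Normalized-0ᵥ++⁻ nw'

  Normalized-·ᵥ⇒≡ : ∀ {m c} {u v : Vec F m} → Normalized u → Normalized v → u ≡ c ·ᵥ v → u ≡ v
  Normalized-·ᵥ⇒≡ {c = c} {x ∷ u} {y ∷ v} nu nv eq with Normalized-∷⁻ nu | Normalized-∷⁻ nv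
  ... | inj₁ x≡1 | inj₁ y≡1 = cong₂ _∷_ (trans x≡1 (sym y≡1))
        (trans (Vec.∷-injectiveʳ eq) (trans (cong (_·ᵥ v) c≡1) (·ᵥ-identityˡ v)))
    where
      c≡1 : c ≡ 1#
      c≡1 = trans (sym (R.*-identityʳ c)) (trans (cong (c ⊗_) (sym y≡1)) (trans (sym (Vec.∷-injectiveˡ eq)) x≡1))
  ... | inj₂ (x≡0 , nu') | inj₂ (y≡0 , nv') = cong₂ _∷_ (trans x≡0 (sym y≡0)) (Normalized-·ᵥ⇒≡ nu' nv' (Vec.∷-injectiveʳ eq))
  ... | inj₁ x≡1 | inj₂ (y≡0 , _) =
        contradiction (trans (sym (trans (Vec.∷-injectiveˡ eq) (trans (cong (c ⊗_) y≡0) (R.zeroʳ c)))) x≡1) 0≢1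
  ... | inj₂ (x≡0 , nu') | inj₁ y≡1 = contradiction (trans (Vec.∷-injectiveʳ eq) (trans (cong (_·ᵥ v) c≡0) (·ᵥ-zeroˡ v)))
        (Normalized⇒≢0ᵥ nu')
    where
      c≡0 : c ≡ 0#
      c≡0 = trans (sym (R.*-identityʳ c)) (trans (cong (c ⊗_) (sym y≡1)) (trans (sym (Vec.∷-injectiveˡ eq)) x≡0))

  Normalized-same-point : ∀ {m a a'} {v v' y : Vec F m} → Normalized v → Normalized v' → y ≢ 0ᵥ
    → y ≡ a ·ᵥ v → y ≡ a' ·ᵥ v' → v ≡ v'
  Normalized-same-point {a = a} {a'} {v} {v'} {y} nv nv' y≢0 y≡av y≡a'v' =
    sym (Normalized-·ᵥ⇒≡ nv' nv v'≡)
    where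
      open ≡-Reasoning
      a'≢0 : a' ≢ 0#
      a'≢0 refl = y≢0 (trans y≡a'v' (·ᵥ-zeroˡ v'))
      v'≡ : v' ≡ (inv a'≢0 ⊗ a) ·ᵥ v
      v'≡ = begin
        v'                        ≡⟨ ·ᵥ-identityˡ v' ⟨
        1# ·ᵥ v'                  ≡⟨ cong (_·ᵥ v') (inv-inverseˡ a'≢0) ⟨
        (inv a'≢0 ⊗ a') ·ᵥ v'     ≡⟨ ·ᵥ-assoc _ a' v' ⟨
        inv a'≢0 ·ᵥ (a' ·ᵥ v')    ≡⟨ cong (inv a'≢0 ·ᵥ_) (trans (sym y≡a'v') y≡av) ⟩
        inv a'≢0 ·ᵥ (a ·ᵥ v)      ≡⟨ ·ᵥ-assoc _ a v ⟩
        (inv a'≢0 ⊗ a) ·ᵥ v       ∎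

  normalize : ∀ {m} {v : Vec F m} → v ≢ 0ᵥ → ∃₂ λ w a → Normalized w × v ≡ a ·ᵥ w
  normalize {v = []} v≢0 = contradiction refl v≢0
  normalize {v = x ∷ v} v≢0 with x ≟ 0#
  ... | no x≢0 = inv x≢0 ·ᵥ (x ∷ v) , x , Normalized-∷⁺ (inj₁ (inv-inverseˡ x≢0)) , sym (begin
        x ·ᵥ (inv x≢0 ·ᵥ (x ∷ v))   ≡⟨ ·ᵥ-assoc x (inv x≢0) (x ∷ v) ⟩
        (x ⊗ inv x≢0) ·ᵥ (x ∷ v)    ≡⟨ cong (_·ᵥ (x ∷ v)) (inv-inverseʳ x≢0) ⟩
        1# ·ᵥ (x ∷ v)               ≡⟨ ·ᵥ-identityˡ (x ∷ v) ⟩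
        x ∷ v                       ∎)
    where open ≡-Reasoning
  ... | yes refl = let w , a , nw , v≡ = normalize (v≢0 ∘ cong (0# ∷_)) in
        0# ∷ w , a , Normalized-∷⁺ (inj₂ (refl , nw)) , cong₂ _∷_ (sym (R.zeroʳ a)) v≡

  normalizedVectors : ∀ m → List (Vec F m)
  normalizedVectors zero = []
  normalizedVectors (suc m) = List.map (1# ∷_) (allVectors m) List.++ List.map (0# ∷_) (normalizedVectors m)

  length-normalizedVectors : ∀ m → length (normalizedVectors m) ≡ [ m ] (q ^ n)
  length-normalizedVectors zero = refl
  length-normalizedVectors (suc m) = trans (List.length-++ (List.map (1# ∷_) (allVectors m)))
    (cong₂ _+_ (trans (List.length-map _ (allVectors m)) (length-allVectors m))
               (trans (List.length-map _ (normalizedVectors m)) (length-normalizedVectors m)))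

  normalizedVectors-Enumerates : ∀ m → Enumerates Normalized (normalizedVectors m)
  normalizedVectors-Enumerates zero = record { unique = [] ; sound = λ () ; complete = λ { (() , _) } }
  normalizedVectors-Enumerates (suc m) = record
    { unique = Unique.++⁺ (Unique.map⁺ Vec.∷-injectiveʳ (Unique-vectors elems-unique m)) (Unique.map⁺ Vec.∷-injectiveʳ unique)
        λ (v∈₁ , v∈₀) → let _ , _ , v≡₁ = ∈-map⁻ (1# ∷_) v∈₁ ; _ , _ , v≡₀ = ∈-map⁻ (0# ∷_) v∈₀ in
          0≢1 (Vec.∷-injectiveˡ (trans (sym v≡₀) v≡₁))
    ; sound = λ v∈ → [ (λ v∈₁ → let _ , _ , v≡ = ∈-map⁻ (1# ∷_) v∈₁ in
                           subst Normalized (sym v≡) (Normalized-∷⁺ (inj₁ refl)))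
                     , (λ v∈₀ → let _ , w∈ , v≡ = ∈-map⁻ (0# ∷_) v∈₀ in
                           subst Normalized (sym v≡) (Normalized-∷⁺ (inj₂ (refl , sound w∈))))
                     ]′ (∈-++⁻ (List.map (1# ∷_) (allVectors m)) v∈)
    ; complete = complete′
    }
    where
      open Enumerates (normalizedVectors-Enumerates m)
      complete′ : ∀ {v} → Normalized v → v ∈ normalizedVectors (suc m)
      complete′ {x ∷ v} nv with Normalized-∷⁻ nv
      ... | inj₁ refl = ∈-++⁺ˡ (∈-map⁺ (1# ∷_) (∈-allVectors v))
      ... | inj₂ (refl , nv') = ∈-++⁺ʳ (List.map (1# ∷_) (allVectors m)) (∈-map⁺ (0# ∷_) (complete nv'))

-- Scattered linear sets

module Scattered {q n : ℕ} (E : FieldExt q n) {d : ℕ} (U₁ : Geometry.VPred E d)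
  (U₁-sub : Geometry.IsKSubspace E U₁) (U₁? : Decidable U₁)
  {h : ℕ} (h<d : suc h < d) (scattered : Geometry.IsHScattered E (suc h) U₁) where
  open FieldExt E
  open Geometry E
  open FiniteField E

  outside-FSpan : ∀ {j} (W : Fin j → Vec F d) → j < d → ∃ λ u → U₁ u × ¬ FSpan W u
  outside-FSpan {j} W j<d with proj₁ scattered
  ... | k , b , b∈U , spans with Fin.all? (λ i → FSpan? W (b i))
  ... | no ¬all = let i , bᵢ∉ = Fin.¬∀⟶∃¬ k _ (λ i → FSpan? W (b i)) ¬all in b i , b∈U i , bᵢ∉
  ... | yes all = contradiction (^-cancelʳ-≤ 1<qⁿ |Fᵈ|≤|span|) (<⇒≱ j<d)
    where
      everything-in-span : ∀ x → FSpan W x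
      everything-in-span x = Fqⁿ.InSpan⇒∈ (Fqⁿ.FSpan-subspace W) all (FSpan⇒InSpan (spans x))
      |Fᵈ|≤|span| : (q ^ n) ^ d ≤ (q ^ n) ^ j
      |Fᵈ|≤|span| = subst₂ _≤_ (length-allVectors d) (trans (Fqⁿ.length-span W) (cong (_^ j) elems-size))
        (Unique-⊆⇒length≤ _≟ᵥ_ (Unique-vectors elems-unique d) (λ {x} _ → Fqⁿ.∈-span⁺ (FSpan⇒InSpan (everything-in-span x))))

  independent-completion : ∀ {v} → v ≢ 0ᵥ → ∀ s → s ≤ h
    → Σ (Fin s → Vec F d) λ T → (∀ j → U₁ (T j)) × Fqⁿ.Independent (v ∷ᶠ T)
  independent-completion {v} v≢0 zero _ =
    (λ ()) , (λ ()) , λ { c _ cv≡0 fzero → ·ᵥ≡0ᵥ⇒≡0 v≢0 (trans (sym (+ᵥ-identityʳ _)) cv≡0) }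
  independent-completion {v} v≢0 (suc s) s<h with independent-completion v≢0 s (≤-trans (n≤1+n s) s<h)
  ... | T , T∈U , ind with outside-FSpan (v ∷ᶠ T) (≤-trans (s≤s s<h) (<⇒≤ h<d))
  ... | u , u∈U , u∉ = u ∷ᶠ T , (λ { fzero → u∈U ; (fsuc j) → T∈U j })
        , Fqⁿ.Independent-swap (Fqⁿ.Independent-∷ {b = v ∷ᶠ T} ind λ (c , _ , u≡) → u∉ (c , u≡))

  -- ⟨v, T⟩ is an (h−1)-space meeting U₁ in the h + 1 independent vectors a₀v, a₁v, T.
  no-independent-multiples : ∀ {v a₀ a₁} → v ≢ 0ᵥ → U₁ (a₀ ·ᵥ v) → U₁ (a₁ ·ᵥ v) → ¬ Fq.Independent₂ a₀ a₁
  no-independent-multiples {v} {a₀} {a₁} v≢0 a₀v∈U a₁v∈U indep₂ with independent-completion v≢0 h ≤-refl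
  ... | T , T∈U , ind = <-irrefl refl (≤-trans (Fq.Independent⇒≤dim S? S-sub hd fam∈S fam-independent) k≤h+1)
    where
      W = v ∷ᶠ T
      S = U₁ ∩ FSpan W
      S? : Decidable S
      S? u = U₁? u ×-dec FSpan? W u
      S-sub = Fq.∩-subspace U₁-sub (Fq.FSpan-subspace W)
      dim = Fq.hasDim S? S-sub
      hd = proj₂ dim
      k≤h+1 : proj₁ dim ≤ suc h
      k≤h+1 = proj₂ scattered W (λ c → ind c (λ _ → elems-complete _)) _ hd

      fam = (a₀ ·ᵥ v) ∷ᶠ (a₁ ·ᵥ v) ∷ᶠ T
      fam∈S : ∀ i → S (fam i)
      fam∈S fzero = a₀v∈U , FSpan-· {W = W} a₀ (FSpan-generator W fzero)
      fam∈S (fsuc fzero) = a₁v∈U , FSpan-· {W = W} a₁ (FSpan-generator W fzero)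
      fam∈S (fsuc (fsuc j)) = T∈U j , FSpan-generator W (fsuc j)

      fam-independent : Fq.Independent fam
      fam-independent c c∈ fam≡0 = λ
        { fzero → proj₁ c₀,c₁≡0 ; (fsuc fzero) → proj₂ c₀,c₁≡0 ; (fsuc (fsuc j)) → g≡0 (fsuc j) }
        where
          open ≡-Reasoning
          c₀ = c fzero
          c₁ = c (fsuc fzero)
          r = lincomb (c ∘ fsuc ∘ fsuc) T
          g = ((c₀ ⊗ a₀) ⊕ (c₁ ⊗ a₁)) ∷ᶠ (c ∘ fsuc ∘ fsuc)
          g≡0 = ind g (λ _ → elems-complete _) (begin
            (((c₀ ⊗ a₀) ⊕ (c₁ ⊗ a₁)) ·ᵥ v) +ᵥ r              ≡⟨ cong (_+ᵥ r) (·ᵥ-distribʳ _ _ v) ⟩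
            (((c₀ ⊗ a₀) ·ᵥ v) +ᵥ ((c₁ ⊗ a₁) ·ᵥ v)) +ᵥ r       ≡⟨ +ᵥ-assoc _ _ r ⟩
            ((c₀ ⊗ a₀) ·ᵥ v) +ᵥ (((c₁ ⊗ a₁) ·ᵥ v) +ᵥ r)
              ≡⟨ cong₂ (λ x y → x +ᵥ (y +ᵥ r)) (·ᵥ-assoc c₀ a₀ v) (·ᵥ-assoc c₁ a₁ v) ⟨
            (c₀ ·ᵥ (a₀ ·ᵥ v)) +ᵥ ((c₁ ·ᵥ (a₁ ·ᵥ v)) +ᵥ r)     ≡⟨ fam≡0 ⟩
            0ᵥ                                                ∎)
          c₀,c₁≡0 = indep₂ c₀ c₁ (c∈ fzero) (c∈ (fsuc fzero)) (g≡0 fzero)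

-- The cone

ConeProperties : ∀ {q n d r} (E : FieldExt q n) → d ≤ r → Geometry.VPred E d → ℕ → ℕ → Set
ConeProperties {q} {n} {r = r} E d≤r U₁ k e =
  HasDimK C (k + n * e)
  × (∀ (v : Vec F r) → v ≢ 0ᵥ → PointWeight C v 0 ⊎ PointWeight C v 1 ⊎ PointWeight C v n)
  × LinearSetSize C (q ^ (n * e) * [ k ] q + [ e ] (q ^ n))
  where
    open FieldExt E using (F)
    open Geometry E
    C = Cone d≤r U₁

module ConeLinearSet {q n : ℕ} (E : FieldExt q n) {d e : ℕ} (d≤ : d ≤ d + e) {U₁ : Geometry.VPred E d}
  (U₁-sub : Geometry.IsKSubspace E U₁) {k : ℕ} (U₁-dim : Geometry.HasDimK E U₁ k) where
  open FieldExt E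
  open Geometry E
  open FiniteField E

  C : VPred (d + e)
  C = Cone d≤ U₁

  -- Cone projects via tabulate and inject≤; truncate is the same projection.
  C⁺ : ∀ {x} → U₁ (truncate d≤ x) → C x
  C⁺ {x} = subst U₁ (sym (tabulate-lookup-inject≤ d≤ x))

  C⁻ : ∀ {x} → C x → U₁ (truncate d≤ x)
  C⁻ {x} = subst U₁ (tabulate-lookup-inject≤ d≤ x)

  U₁? : Decidable U₁
  U₁? = Fq.HasDim⇒Decidable U₁-sub U₁-dim

  C? : Decidable C
  C? x = U₁? _

  C-subspace : IsKSubspace C
  C-subspace = let U0 , U+ , U· = U₁-sub in
      C⁺ (subst U₁ (sym (truncate-replicate d≤ 0#)) U0)
    , (λ u v u∈ v∈ → C⁺ (subst U₁ (sym (truncate-zipWith _⊕_ d≤ u v)) (U+ _ _ (C⁻ u∈) (C⁻ v∈))))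
    , (λ a u a∈ u∈ → C⁺ (subst U₁ (sym (truncate-map (a ⊗_) d≤ u)) (U· a _ a∈ (C⁻ u∈))))

  coneVectors : List (Vec F (d + e))
  coneVectors = cartesianProductWith _++_ (enumerate U₁?) (allVectors e)

  coneVectors-Enumerates : Enumerates C coneVectors
  coneVectors-Enumerates = record
    { unique = Unique.cartesianProductWith⁺ _++_ (λ {u} {u'} → Vec.++-injective u u') U.unique (Unique-vectors elems-unique e)
    ; sound = λ x∈ → let u , w , u∈ , _ , x≡ = ∈-cartesianProductWith⁻ _++_ (enumerate U₁?) (allVectors e) x∈ in
        C⁺ (subst U₁ (sym (trans (cong (truncate d≤) x≡) (truncate-++ d≤ u w))) (U.sound u∈))
    ; complete = λ {x} x∈C → let u , w , x≡ = splitAt d x in subst (_∈ coneVectors) (sym x≡)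
        (∈-cartesianProductWith⁺ _++_ (U.complete (subst U₁ (trans (cong (truncate d≤) x≡) (truncate-++ d≤ u w)) (C⁻ x∈C)))
          (∈-allVectors w))
    }
    where module U = Enumerates (enumerate-Enumerates U₁?)

  length-coneVectors : length coneVectors ≡ q ^ (k + n * e)
  length-coneVectors = begin
    length coneVectors                              ≡⟨ length-cartesianProductWith _++_ (enumerate U₁?) (allVectors e) ⟩
    length (enumerate U₁?) * length (allVectors e)  ≡⟨ cong₂ _*_ (HasDimK⇒length≡ U₁-sub U₁-dim (enumerate-Enumerates U₁?))
                                                                 (length-allVectors e) ⟩
    q ^ k * (q ^ n) ^ e                             ≡⟨ cong (q ^ k *_) (^-*-assoc q n e) ⟩
    q ^ k * q ^ (n * e)                             ≡⟨ ^-distribˡ-+-* q k (n * e) ⟨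
    q ^ (k + n * e)                                 ∎
    where open ≡-Reasoning

  rank : HasDimK C (k + n * e)
  rank = length≡⇒HasDimK C? C-subspace coneVectors-Enumerates length-coneVectors

  C∩⟨_⟩ : Vec F (d + e) → VPred (d + e)
  C∩⟨ v ⟩ = C ∩ FSpan ⟨ v ⟩

  C∩⟨⟩? : ∀ v → Decidable C∩⟨ v ⟩
  C∩⟨⟩? v u = C? u ×-dec FSpan? ⟨ v ⟩ u

  C∩⟨⟩-subspace : ∀ v → IsKSubspace C∩⟨ v ⟩
  C∩⟨⟩-subspace v = Fq.∩-subspace C-subspace (Fq.FSpan-subspace ⟨ v ⟩)

  pointVectors : Vec F (d + e) → List (Vec F (d + e))
  pointVectors v = filter C? (multiples v)

  pointVectors-Enumerates : ∀ {v} → v ≢ 0ᵥ → Enumerates C∩⟨ v ⟩ (pointVectors v)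
  pointVectors-Enumerates v≢0 = Enumerates-filter C? (multiples-Enumerates v≢0)

  vertex-weight : ∀ {v} → v ≢ 0ᵥ → truncate d≤ v ≡ 0ᵥ → PointWeight C v n
  vertex-weight {v} v≢0 tv≡0 = length≡⇒HasDimK (C∩⟨⟩? v) (C∩⟨⟩-subspace v) multiples-Enumerates′
    (trans (List.length-map _ elems) elems-size)
    where
      module M = Enumerates (multiples-Enumerates v≢0)
      multiple∈C : ∀ a → C (a ·ᵥ v)
      multiple∈C a = C⁺ (subst U₁ (sym (trans (truncate-map (a ⊗_) d≤ v) (trans (cong (a ·ᵥ_) tv≡0) (·ᵥ-zeroʳ a))))
        (proj₁ U₁-sub))
      multiples-Enumerates′ : Enumerates C∩⟨ v ⟩ (multiples v)
      multiples-Enumerates′ = record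
        { unique = M.unique
        ; sound = λ u∈ → (let a , u≡ = FSpan-single⁻ (M.sound u∈) in subst C (sym u≡) (multiple∈C a)) , M.sound u∈
        ; complete = M.complete ∘ proj₂
        }

  IsPoint : VPred (d + e)
  IsPoint v = Normalized v × InLinearSet C v

  IsPoint? : Decidable IsPoint
  IsPoint? v = Normalized? v ×-dec InLinearSet? C? v

  points : List (Vec F (d + e))
  points = enumerate IsPoint?

  module Points = Enumerates (enumerate-Enumerates IsPoint?)

  point≢0ᵥ : ∀ {v} → IsPoint v → v ≢ 0ᵥ
  point≢0ᵥ = Normalized⇒≢0ᵥ ∘ proj₁

  fiber : Vec F (d + e) → List (Vec F (d + e))
  fiber v = remove _≟ᵥ_ 0ᵥ (pointVectors v)

  fiber-Enumerates : ∀ {v} → v ≢ 0ᵥ → Enumerates (λ u → u ≢ 0ᵥ × C∩⟨ v ⟩ u) (fiber v)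
  fiber-Enumerates v≢0 = Enumerates-filter (λ u → ¬? (u ≟ᵥ 0ᵥ)) (pointVectors-Enumerates v≢0)

  suc-length-fiber : ∀ {v w} → v ≢ 0ᵥ → PointWeight C v w → suc (length (fiber v)) ≡ q ^ w
  suc-length-fiber {v} v≢0 hd =
    trans (length-remove _≟ᵥ_ PV.unique (PV.complete (proj₁ C-subspace , FSpan-0 ⟨ v ⟩)))
          (HasDimK⇒length≡ (C∩⟨⟩-subspace v) hd (pointVectors-Enumerates v≢0))
    where module PV = Enumerates (pointVectors-Enumerates v≢0)

  nonzeroConeVectors : List (Vec F (d + e))
  nonzeroConeVectors = remove _≟ᵥ_ 0ᵥ coneVectors

  suc-length-nonzeroConeVectors : suc (length nonzeroConeVectors) ≡ q ^ (k + n * e)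
  suc-length-nonzeroConeVectors =
    trans (length-remove _≟ᵥ_ CV.unique (CV.complete (proj₁ C-subspace))) length-coneVectors
    where module CV = Enumerates coneVectors-Enumerates

  fibers-Enumerates : Enumerates (λ u → u ≢ 0ᵥ × C u) (concatMap fiber points)
  fibers-Enumerates = record
    { unique = Unique-concatMap fiber Points.unique (λ v∈ → Enumerates.unique (fiber-Enumerates (point≢0ᵥ (Points.sound v∈))))
        same-point
    ; sound = λ u∈ → let _ , v∈ , u∈fiber = find (∈-concatMap⁻ fiber u∈) ; u≢0 , u∈C , _ = fiber⁻ v∈ u∈fiber in
        u≢0 , u∈C
    ; complete = λ {u} (u≢0 , u∈C) → let w , a , nw , u≡ = normalize u≢0 in
        ∈-concatMap⁺ fiber (lose (Points.complete (nw , u , u∈C , u≢0 , a , u≡))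
          (Enumerates.complete (fiber-Enumerates (Normalized⇒≢0ᵥ nw)) (u≢0 , u∈C , subst (FSpan ⟨ w ⟩) (sym u≡) (FSpan-single⁺ a))))
    }
    where
      fiber⁻ : ∀ {v u} → v ∈ points → u ∈ fiber v → u ≢ 0ᵥ × C∩⟨ v ⟩ u
      fiber⁻ v∈ = Enumerates.sound (fiber-Enumerates (point≢0ᵥ (Points.sound v∈)))
      same-point : ∀ {v v' u} → v ∈ points → v' ∈ points → u ∈ fiber v → u ∈ fiber v' → v ≡ v'
      same-point v∈ v'∈ u∈ u∈' =
        let u≢0 , _ , u∈⟨v⟩ = fiber⁻ v∈ u∈ ; _ , _ , u∈⟨v'⟩ = fiber⁻ v'∈ u∈' in
        Normalized-same-point (proj₁ (Points.sound v∈)) (proj₁ (Points.sound v'∈)) u≢0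
          (proj₂ (FSpan-single⁻ u∈⟨v⟩)) (proj₂ (FSpan-single⁻ u∈⟨v'⟩))

  vertex? : Decidable (λ v → truncate d≤ v ≡ 0ᵥ)
  vertex? v = truncate d≤ v ≟ᵥ 0ᵥ

  vertexPoints-Enumerates : Enumerates (λ v → truncate d≤ v ≡ 0ᵥ × IsPoint v) (List.map (0ᵥ ++_) (normalizedVectors e))
  vertexPoints-Enumerates = record
    { unique = Unique.map⁺ (Vec.++-injectiveʳ 0ᵥ 0ᵥ) NV.unique
    ; sound = λ v∈ → let w , w∈ , v≡ = ∈-map⁻ (0ᵥ ++_) v∈ in subst (λ v → truncate d≤ v ≡ 0ᵥ × IsPoint v) (sym v≡)
        (truncate-++ d≤ 0ᵥ w , Normalized-0ᵥ++⁺ (NV.sound w∈) , 0ᵥ ++ w , C⁺ (subst U₁ (sym (truncate-++ d≤ 0ᵥ w)) (proj₁ U₁-sub))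
        , Normalized⇒≢0ᵥ (Normalized-0ᵥ++⁺ (NV.sound w∈)) , 1# , sym (·ᵥ-identityˡ _))
    ; complete = complete′
    }
    where
      module NV = Enumerates (normalizedVectors-Enumerates e)
      complete′ : ∀ {v} → truncate d≤ v ≡ 0ᵥ × IsPoint v → v ∈ List.map (0ᵥ ++_) (normalizedVectors e)
      complete′ {v} (tv≡0 , nv , _) with splitAt d v
      ... | u , w , refl with trans (sym (truncate-++ d≤ u w)) tv≡0
      ... | refl = ∈-map⁺ (0ᵥ ++_) (NV.complete (Normalized-0ᵥ++⁻ nv))

  length-vertexPoints : length (filter vertex? points) ≡ [ e ] (q ^ n)
  length-vertexPoints = trans
    (Enumerates⇒length≡ _≟ᵥ_ (Enumerates-filter vertex? (enumerate-Enumerates IsPoint?)) vertexPoints-Enumerates)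
    (trans (List.length-map _ (normalizedVectors e)) (length-normalizedVectors e))

  module _ {h : ℕ} (h<d : suc h < d) (scattered : IsHScattered (suc h) U₁) where
    open Scattered E U₁ U₁-sub U₁? h<d scattered

    off-vertex-weight≤1 : ∀ {v w} → truncate d≤ v ≢ 0ᵥ → HasDimK C∩⟨ v ⟩ w → w ≤ 1
    off-vertex-weight≤1 {w = zero} _ _ = z≤n
    off-vertex-weight≤1 {w = suc zero} _ _ = ≤-refl
    off-vertex-weight≤1 {v} {suc (suc w)} tv≢0 (b , b∈ , ind , _)
      with FSpan-single⁻ (proj₂ (b∈ fzero)) | FSpan-single⁻ (proj₂ (b∈ (fsuc fzero)))
    ... | a₀ , b₀≡ | a₁ , b₁≡ = contradiction (Fq.multiples-independent {b = b} ind b₀≡ b₁≡)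
          (no-independent-multiples tv≢0 (truncate-multiple b₀≡ (proj₁ (b∈ fzero)))
                                         (truncate-multiple b₁≡ (proj₁ (b∈ (fsuc fzero)))))
      where
        truncate-multiple : ∀ {u a} → u ≡ a ·ᵥ v → C u → U₁ (a ·ᵥ truncate d≤ v)
        truncate-multiple {a = a} refl u∈C = subst U₁ (truncate-map (a ⊗_) d≤ v) (C⁻ u∈C)

    point-weight : ∀ {v} → v ≢ 0ᵥ → PointWeight C v 0 ⊎ PointWeight C v 1 ⊎ PointWeight C v n
    point-weight {v} v≢0 with truncate d≤ v ≟ᵥ 0ᵥ
    ... | yes tv≡0 = inj₂ (inj₂ (vertex-weight v≢0 tv≡0))
    ... | no tv≢0 = off-vertex tv≢0 (Fq.hasDim (C∩⟨⟩? v) (C∩⟨⟩-subspace v))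
      where
        off-vertex : truncate d≤ v ≢ 0ᵥ → ∃ (HasDimK C∩⟨ v ⟩) → PointWeight C v 0 ⊎ PointWeight C v 1 ⊎ PointWeight C v n
        off-vertex _ (zero , hd) = inj₁ hd
        off-vertex _ (suc zero , hd) = inj₂ (inj₁ hd)
        off-vertex tv≢0 (suc (suc _) , hd) = contradiction (off-vertex-weight≤1 tv≢0 hd) λ { (s≤s ()) }

    suc-length-fiber-vertex : ∀ {v} → IsPoint v → truncate d≤ v ≡ 0ᵥ → suc (length (fiber v)) ≡ q ^ n
    suc-length-fiber-vertex pv tv≡0 = suc-length-fiber (point≢0ᵥ pv) (vertex-weight (point≢0ᵥ pv) tv≡0)

    suc-length-fiber-offVertex : ∀ {v} → IsPoint v → truncate d≤ v ≢ 0ᵥ → suc (length (fiber v)) ≡ q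
    suc-length-fiber-offVertex {v} pv@(_ , u , u∈C , u≢0 , a , u≡) tv≢0 = by-weight (Fq.hasDim (C∩⟨⟩? v) (C∩⟨⟩-subspace v))
      where
        u∈fiber : u ∈ fiber v
        u∈fiber = Enumerates.complete (fiber-Enumerates (point≢0ᵥ pv)) (u≢0 , u∈C , subst (FSpan ⟨ v ⟩) (sym u≡) (FSpan-single⁺ a))
        by-weight : ∃ (HasDimK C∩⟨ v ⟩) → suc (length (fiber v)) ≡ q
        by-weight (zero , hd) = contradiction (sym (suc-injective (suc-length-fiber (point≢0ᵥ pv) hd))) (<⇒≢ (∈-length u∈fiber))
        by-weight (suc zero , hd) = trans (suc-length-fiber (point≢0ᵥ pv) hd) (*-identityʳ q)
        by-weight (suc (suc _) , hd) = contradiction (off-vertex-weight≤1 tv≢0 hd) λ { (s≤s ()) }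

    length-nonzeroConeVectors : length nonzeroConeVectors
      ≡ (q ^ n ∸ 1) * length (filter vertex? points) + (q ∸ 1) * length (filter (∁? vertex?) points)
    length-nonzeroConeVectors = trans
      (Enumerates⇒length≡ _≟ᵥ_ (Enumerates-filter (λ u → ¬? (u ≟ᵥ 0ᵥ)) coneVectors-Enumerates) fibers-Enumerates)
      (length-concatMap-twoValued fiber vertex? points
        (λ v∈ tv≡0 → cong (_∸ 1) (suc-length-fiber-vertex (Points.sound v∈) tv≡0))
        (λ v∈ tv≢0 → cong (_∸ 1) (suc-length-fiber-offVertex (Points.sound v∈) tv≢0)))

    length-offVertexPoints : length (filter (∁? vertex?) points) ≡ q ^ (n * e) * [ k ] q
    length-offVertexPoints = *-cancelˡ-≡ X (Qₑ * [ k ] q) a {{>-nonZero (≤-pred (subst (1 <_) (sym q≡) 1<q))}}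
      (+-cancelˡ-≡ Qₑ _ _ (begin
        Qₑ + a * X                       ≡⟨ cong (_+ a * X) vertex-count ⟨
        suc (A * Y) + a * X              ≡⟨ cong suc length-nonzeroConeVectors ⟨
        suc (length nonzeroConeVectors)  ≡⟨ suc-length-nonzeroConeVectors ⟩
        q ^ (k + n * e)                  ≡⟨ ^-distribˡ-+-* q k (n * e) ⟩
        q ^ k * Qₑ                       ≡⟨ cong (_* Qₑ) (subst (λ x → suc (a * [ k ] x) ≡ x ^ k) q≡ ([]-geometric a k)) ⟨
        Qₑ + a * [ k ] q * Qₑ            ≡⟨ cong (Qₑ +_) (trans (*-assoc a ([ k ] q) Qₑ) (cong (a *_) (*-comm ([ k ] q) Qₑ))) ⟩
        Qₑ + a * (Qₑ * [ k ] q)          ∎))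
      where
        open ≡-Reasoning
        Qₑ = q ^ (n * e)
        X = length (filter (∁? vertex?) points)
        Y = length (filter vertex? points)
        a = q ∸ 1
        A = q ^ n ∸ 1
        q≡ : suc a ≡ q
        q≡ = m+[n∸m]≡n (<⇒≤ 1<q)
        vertex-count : suc (A * Y) ≡ Qₑ
        vertex-count = begin
          suc (A * Y)              ≡⟨ cong (λ y → suc (A * y)) length-vertexPoints ⟩
          suc (A * [ e ] (q ^ n))  ≡⟨ subst (λ x → suc (A * [ e ] x) ≡ x ^ e) (m+[n∸m]≡n (<⇒≤ 1<qⁿ)) ([]-geometric A e) ⟩
          (q ^ n) ^ e              ≡⟨ ^-*-assoc q n e ⟩
          Qₑ                       ∎

    length-points : length points ≡ q ^ (n * e) * [ k ] q + [ e ] (q ^ n)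
    length-points = begin
      length points                                                            ≡⟨ length-filter+length-filter-∁ vertex? points ⟨
      length (filter vertex? points) + length (filter (∁? vertex?) points)     ≡⟨ +-comm (length (filter vertex? points)) _ ⟩
      length (filter (∁? vertex?) points) + length (filter vertex? points)     ≡⟨ cong₂ _+_ length-offVertexPoints length-vertexPoints ⟩
      q ^ (n * e) * [ k ] q + [ e ] (q ^ n)                                    ∎
      where open ≡-Reasoning

    theorem : ConeProperties E d≤ U₁ k e
    theorem = rank , (λ _ → point-weight) , points , Points.unique , (λ _ → Points.sound)
      , (λ _ nv iv → Points.complete (nv , iv)) , length-points

lemma4p2 : ∀ {q n : ℕ} (E : FieldExt q n) (r d h : ℕ)
    → 2 ≤ r → 1 ≤ d → (d≤r : d ≤ r) → 1 ≤ h → h ≤ d ∸ 1 → suc h ∣ d * n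
    → (U₁ : Vec (FieldExt.F E) d → Set)
    → Geometry.IsKSubspace E U₁
    → Geometry.IsProperlyMaxHScattered E h U₁
    → Geometry.HasDimK E (Geometry.Cone E d≤r U₁) ((d * n) / suc h + n * (r ∸ d))
      × (∀ (v : Vec (FieldExt.F E) r) → v ≢ Geometry.0ᵥ E
          → Geometry.PointWeight E (Geometry.Cone E d≤r U₁) v 0
            ⊎ Geometry.PointWeight E (Geometry.Cone E d≤r U₁) v 1
            ⊎ Geometry.PointWeight E (Geometry.Cone E d≤r U₁) v n)
      × Geometry.LinearSetSize E (Geometry.Cone E d≤r U₁)
          (q ^ (n * (r ∸ d)) * [ (d * n) / suc h ] q + [ r ∸ d ] (q ^ n))
lemma4p2 E r d zero _ _ d≤r () _ _ U₁ _ _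
lemma4p2 {n = n} E r d (suc h) _ 1≤d d≤r _ h≤d∸1 _ U₁ U₁-sub (scattered , U₁-dim) = at-rank d≤r (m+[n∸m]≡n d≤r)
  where
    h<d : suc h < d
    h<d = ≤-trans (s≤s h≤d∸1) (≤-reflexive (m+[n∸m]≡n 1≤d))
    at-rank : ∀ {r e} (d≤r : d ≤ r) → d + e ≡ r → ConeProperties E d≤r U₁ ((d * n) / suc (suc h)) (r ∸ d)
    at-rank {e = e} d≤r refl = subst (ConeProperties E d≤r U₁ _) (sym (m+n∸m≡n d e))
      (ConeLinearSet.theorem E d≤r U₁-sub U₁-dim h<d scattered)
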